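{- Let $k$ be a number field and $m\geq n\geq1$ integers. There are exactly $n$ double cosets in $P_{mn-1,1}(k)\backslash\mathrm{GL}_{mn}(k)/T_{m,n}(k)$, and the elements $$\varepsilon_r=\begin{pmatrix}I_{(m-r)n-1}&&\\&&I_{rn}\\&1&\end{pmatrix}\begin{pmatrix}I_{(m-r)n-1}&0&0\\&1&\underline{b_r}\\&&I_{rn}\end{pmatrix},\qquad 0\leq r\leq n-1,$$ with $\underline{b_r}=(e_{n-1}^T,e_{n-2}^T,\dots,e_{n-r}^T)\in k^{rn}$, form a set of representatives.
   Context: $P_{mn-1,1}$ is the parabolic subgroup of $\mathrm{GL}_{mn}$ of matrices $\begin{pmatrix}A&X\\0&d\end{pmatrix}$ with $A\in\mathrm{GL}_{mn-1}$, $d\in\mathrm{GL}_1$. For $h=(h_{ij})\in\mathrm{GL}_m(k)$, $g\in\mathrm{GL}_n(k)$, the Kronecker product $t(h,g)$ is the $mn\times mn$ block matrix whose $(i,j)$ block is $h_{ij}g$, and $T_{m,n}(k)=\{t(h,g)\}$ is its image. $e_1,\dots,e_n$ is the standard column basis of $k^n$ (so $e_i^T$ are row vectors); for $r=0$, $\varepsilon_0=I_{mn}$. -}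

module Defs where

open import Level using (Level; _⊔_) renaming (suc to lsuc)
open import Data.Nat as ℕ using (ℕ; zero; suc; _∸_; _≡ᵇ_; _<ᵇ_; _≤ᵇ_)
open import Data.Bool using (Bool; true; false; if_then_else_; _∧_; _∨_)
open import Data.Fin as Fin using (Fin; toℕ; remQuot)
open import Data.List using (List; []; _∷_; map; upTo; concatMap)
open import Data.Product using (Σ; ∃; _×_; _,_; proj₁; proj₂)
open import Relation.Nullary using (¬_)
open import Relation.Binary.PropositionalEquality using (_≡_)
open import Algebra.Bundles using (CommutativeRing)
import Data.Rational as ℚ

sumFin : ∀ {a} {A : Set a} → (A → A → A) → A → ∀ {n} → (Fin n → A) → A
sumFin _⊕_ z {zero}  f = z
sumFin _⊕_ z {suc n} f = f Fin.zero ⊕ sumFin _⊕_ z (λ i → f (Fin.suc i))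

record NumberField (c ℓ : Level) : Set (lsuc (c ⊔ ℓ)) where
  field
    commRing : CommutativeRing c ℓ
  open CommutativeRing commRing public
  Σk : ∀ {n} → (Fin n → Carrier) → Carrier
  Σk = sumFin _+_ 0#
  field
    0≉1     : ¬ (0# ≈ 1#)
    inverse : ∀ x → ¬ (x ≈ 0#) → ∃ λ y → x * y ≈ 1#
    ι   : ℚ.ℚ → Carrier
    ι-+ : ∀ p q → ι (p ℚ.+ q) ≈ ι p + ι q
    ι-* : ∀ p q → ι (p ℚ.* q) ≈ ι p * ι q
    ι-1 : ι ℚ.1ℚ ≈ 1#
    degree      : ℕ
    basis       : Fin degree → Carrier
    spanning    : ∀ x → ∃ λ (q : Fin degree → ℚ.ℚ) → x ≈ Σk (λ i → ι (q i) * basis i)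
    independent : ∀ (q : Fin degree → ℚ.ℚ) → Σk (λ i → ι (q i) * basis i) ≈ 0#
                  → ∀ i → q i ≡ ℚ.0ℚ

-- Boolean list helpers used for the row vector b_r.
-- e_i^T as a length-n row vector (i is 1-based, as in the paper).
eRow : ℕ → ℕ → List Bool
eRow n i = map (λ u → suc u ≡ᵇ i) (upTo n)

bRow : (n r : ℕ) → List Bool
bRow n r = concatMap (λ t → eRow n (n ∸ suc t)) (upTo r)

nth : List Bool → ℕ → Bool
nth []       _       = false
nth (x ∷ xs) zero    = x
nth (x ∷ xs) (suc s) = nth xs s

module Mat {c ℓ : Level} (K : NumberField c ℓ) where
  open NumberField K

  Matrix : ℕ → Set c
  Matrix N = Fin N → Fin N → Carrier

  _≋_ : ∀ {N} → Matrix N → Matrix N → Set ℓ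
  A ≋ B = ∀ i j → A i j ≈ B i j

  _⊗_ : ∀ {N} → Matrix N → Matrix N → Matrix N
  (A ⊗ B) i j = Σk (λ l → A i l * B l j)

  I : ∀ {N} → Matrix N
  I i j = if toℕ i ≡ᵇ toℕ j then 1# else 0#

  fromBool : Bool → Carrier
  fromBool b = if b then 1# else 0#

  IsInvertible : ∀ {N} → Matrix N → Set (c ⊔ ℓ)
  IsInvertible {N} A = ∃ λ (B : Matrix N) → (A ⊗ B) ≋ I × (B ⊗ A) ≋ I

  InP : ∀ {N} → Matrix N → Set (c ⊔ ℓ)
  InP {N} p = IsInvertible p ×
    (∀ i j → toℕ i ≡ N ∸ 1 → toℕ j ℕ.< N ∸ 1 → p i j ≈ 0#)

  -- Kronecker product t(h,g): the (i,j) block is h_ij g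
  kron : ∀ {m n} → Matrix m → Matrix n → Matrix (m ℕ.* n)
  kron {m} {n} h g a b =
    h (proj₁ (remQuot {m} n a)) (proj₁ (remQuot {m} n b))
      * g (proj₂ (remQuot {m} n a)) (proj₂ (remQuot {m} n b))

  InT : (m n : ℕ) → Matrix (m ℕ.* n) → Set (c ⊔ ℓ)
  InT m n t = ∃ λ (h : Matrix m) → ∃ λ (g : Matrix n) →
    IsInvertible h × IsInvertible g × t ≋ kron h g

  SameDoubleCoset : (m n : ℕ) → Matrix (m ℕ.* n) → Matrix (m ℕ.* n) → Set (c ⊔ ℓ)
  SameDoubleCoset m n x y = ∃ λ p → ∃ λ t → InP p × InT m n t × y ≋ ((p ⊗ x) ⊗ t)

  -- first factor of ε_r: block matrix with row blocks (a, rn, 1), column blocks (a, 1, rn),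
  -- where a = (m-r)n-1:  [[I_a,0,0],[0,0,I_rn],[0,1,0]]
  εW : (m n r : ℕ) → Matrix (m ℕ.* n)
  εW m n r i j =
    let a = (m ∸ r) ℕ.* n ∸ 1
        N = m ℕ.* n
        i' = toℕ i
        j' = toℕ j
    in fromBool (((i' <ᵇ a) ∧ (j' ≡ᵇ i'))
              ∨ (((a ≤ᵇ i') ∧ (i' <ᵇ a ℕ.+ r ℕ.* n)) ∧ (j' ≡ᵇ suc i'))
              ∨ ((i' ≡ᵇ N ∸ 1) ∧ (j' ≡ᵇ a)))

  -- second factor of ε_r: [[I_a,0,0],[0,1,b_r],[0,0,I_rn]]
  εU : (m n r : ℕ) → Matrix (m ℕ.* n)
  εU m n r i j =
    let a = (m ∸ r) ℕ.* n ∸ 1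
        i' = toℕ i
        j' = toℕ j
    in if i' ≡ᵇ j' then 1#
       else fromBool (((i' ≡ᵇ a) ∧ (a <ᵇ j')) ∧ nth (bRow n r) (j' ∸ suc a))

  ε : (m n r : ℕ) → Matrix (m ℕ.* n)
  ε m n r = εW m n r ⊗ εU m n r

-- A double coset P g T is determined by the last row of g: P only rescales it (its
-- corner entry is invertible), while t(h,g) acts on the last row, reshaped into an m × n
-- matrix X, by X ↦ hᵀ X g; conversely, if y and x t have the same last row then
-- y = (y (x t)⁻¹) x t with y (x t)⁻¹ ∈ P. Hence double cosets correspond to nonzero
-- m × n matrices up to equivalence, that is to the ranks 1, …, n. The reshaped last row
-- of ε_r is an anti-diagonal of r + 1 ones, of rank r + 1. Ranks are compared without
-- determinants: Gaussian elimination (available since x ≈ 0 is decidable in a number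
-- field) brings a matrix to the form I_k ⊕ 0, and a matrix with an s × s identity minor
-- cannot factor through fewer than s dimensions.
module Submission where

open import Level using (Level; _⊔_)
open import Algebra.Bundles using (CommutativeRing)
open import Data.Bool using (Bool; true; false; T; if_then_else_; _∧_; _∨_)
open import Data.Bool.Properties using (T-≡)
open import Data.Fin as Fin using (Fin; toℕ; fromℕ; fromℕ<; inject≤; combine; remQuot; _↑ˡ_; _↑ʳ_)
import Data.Fin.Properties as Fin
open import Data.Fin.Properties
  using (toℕ-injective; toℕ-fromℕ; toℕ-fromℕ<; toℕ≤pred[n]; toℕ<n; toℕ-combine; remQuot-combine;
         combine-remQuot; combine-injectiveˡ; combine-injectiveʳ; all?; ¬∀⟶∃¬)
open import Data.Fin.Permutation as Perm using (Permutation′; permutation; transpose; _⟨$⟩ʳ_; _⟨$⟩ˡ_)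
open import Data.Nat as ℕ using (ℕ; zero; suc; z≤n; s≤s; _≤_; _<_; _∸_; _≡ᵇ_; _<ᵇ_; _≤ᵇ_)
import Data.Nat.Properties as ℕ
open import Data.Product using (∃; ∃₂; _×_; _,_; proj₁; proj₂; uncurry)
open import Data.Sum using (_⊎_; inj₁; inj₂)
open import Function using (_∘_)
open import Function.Bundles using (Equivalence)
open import Relation.Binary.Bundles using (Setoid)
open import Relation.Binary.PropositionalEquality as ≡ using (_≡_; _≢_)
open import Relation.Nullary using (¬_; Dec; yes; no; contradiction)
import Relation.Binary.Reasoning.Setoid
import Data.Rational as ℚ
open import Defs

T⇒≡true : ∀ {b} → T b → b ≡ true
T⇒≡true = Equivalence.to T-≡

¬T⇒≡false : ∀ {b} → ¬ T b → b ≡ false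
¬T⇒≡false {false} _   = ≡.refl
¬T⇒≡false {true}  ¬tt = contradiction _ ¬tt

≡ᵇ-true : ∀ {m n} → m ≡ n → (m ≡ᵇ n) ≡ true
≡ᵇ-true {m} {n} = T⇒≡true ∘ ℕ.≡⇒≡ᵇ m n

≡ᵇ-false : ∀ {m n} → m ≢ n → (m ≡ᵇ n) ≡ false
≡ᵇ-false {m} {n} m≢n = ¬T⇒≡false (m≢n ∘ ℕ.≡ᵇ⇒≡ m n)

≡ᵇ-true⇒≡ : ∀ {m n} → (m ≡ᵇ n) ≡ true → m ≡ n
≡ᵇ-true⇒≡ {m} {n} = ℕ.≡ᵇ⇒≡ m n ∘ Equivalence.from T-≡

≡ᵇ-sym : ∀ m n → (m ≡ᵇ n) ≡ (n ≡ᵇ m)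
≡ᵇ-sym zero    zero    = ≡.refl
≡ᵇ-sym zero    (suc n) = ≡.refl
≡ᵇ-sym (suc m) zero    = ≡.refl
≡ᵇ-sym (suc m) (suc n) = ≡ᵇ-sym m n

<ᵇ-true : ∀ {m n} → m < n → (m <ᵇ n) ≡ true
<ᵇ-true = T⇒≡true ∘ ℕ.<⇒<ᵇ

<ᵇ-false : ∀ {m n} → n ≤ m → (m <ᵇ n) ≡ false
<ᵇ-false {m} {n} n≤m = ¬T⇒≡false (λ m<n → ℕ.<⇒≱ (ℕ.<ᵇ⇒< m n m<n) n≤m)

<ᵇ-true⇒< : ∀ {m n} → (m <ᵇ n) ≡ true → m < n
<ᵇ-true⇒< {m} {n} = ℕ.<ᵇ⇒< m n ∘ Equivalence.from T-≡

≤ᵇ-true : ∀ {m n} → m ≤ n → (m ≤ᵇ n) ≡ true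
≤ᵇ-true = T⇒≡true ∘ ℕ.≤⇒≤ᵇ

≤ᵇ-false : ∀ {m n} → n < m → (m ≤ᵇ n) ≡ false
≤ᵇ-false {m} {n} n<m = ¬T⇒≡false (λ m≤n → ℕ.<⇒≱ n<m (ℕ.≤ᵇ⇒≤ m n m≤n))

module Matrices {c ℓ : Level} (R : CommutativeRing c ℓ) where

  open CommutativeRing R
  open import Algebra.Properties.Semiring.Sum semiring public
    using (sum; sum-syntax; sum-cong-≋; sum-replicate-zero; ∑-distrib-+; ∑-comm; *-distribˡ-sum; *-distribʳ-sum)
  open import Algebra.Properties.Ring ring using (-1*x≈-x; -‿distribˡ-*)
  open import Algebra.Properties.AbelianGroup +-abelianGroup using (xyx⁻¹≈y)
  module ≈-Reasoning = Relation.Binary.Reasoning.Setoid setoid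
  open import Algebra.Properties.CommutativeSemigroup *-commutativeSemigroup using ()
    renaming (interchange to *-interchange; x∙yz≈yx∙z to *-x∙yz≈yx∙z; xy∙z≈y∙xz to *-xy∙z≈y∙xz)
  open import Algebra.Properties.CommutativeSemigroup +-commutativeSemigroup using ()
    renaming (x∙yz≈yx∙z to +-x∙yz≈yx∙z)

  sumFin≡sum : ∀ {n} (f : Fin n → Carrier) → sumFin _+_ 0# f ≡ sum f
  sumFin≡sum {zero}  f = ≡.refl
  sumFin≡sum {suc n} f = ≡.cong (f Fin.zero +_) (sumFin≡sum (λ i → f (Fin.suc i)))

  sum-zero : ∀ {n} {f : Fin n → Carrier} → (∀ i → f i ≈ 0#) → sum f ≈ 0#
  sum-zero {n} f≈0 = trans (sum-cong-≋ f≈0) (sum-replicate-zero n)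

  sum-supported : ∀ {n} {f : Fin n → Carrier} (i : Fin n) → (∀ l → l ≢ i → f l ≈ 0#) → sum f ≈ f i
  sum-supported {suc n} Fin.zero    f≈0 = trans (+-congˡ (sum-zero (λ l → f≈0 (Fin.suc l) λ ()))) (+-identityʳ _)
  sum-supported {suc n} (Fin.suc i) f≈0 =
    trans (+-cong (f≈0 Fin.zero λ ()) (sum-supported i λ l l≢i → f≈0 (Fin.suc l) (l≢i ∘ Fin.suc-injective)))
          (+-identityˡ _)

  sum-split : ∀ a {b} (f : Fin (a ℕ.+ b) → Carrier) →
              sum f ≈ sum (λ i → f (i ↑ˡ b)) + sum (λ j → f (a ↑ʳ j))
  sum-split zero    f = sym (+-identityˡ _)
  sum-split (suc a) f = trans (+-congˡ (sum-split a (f ∘ Fin.suc))) (sym (+-assoc _ _ _))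

  sum-combine : ∀ {m n} (f : Fin (m ℕ.* n) → Carrier) →
                sum f ≈ sum (λ i → sum (λ j → f (combine {m} {n} i j)))
  sum-combine {zero}      f = refl
  sum-combine {suc m} {n} f = trans (sum-split n f) (+-congˡ (sum-combine {m} (λ x → f (n ↑ʳ x))))

  sum-product : ∀ {m n} (f : Fin m → Carrier) (g : Fin n → Carrier) →
                sum f * sum g ≈ sum (λ i → sum (λ j → f i * g j))
  sum-product f g = trans (*-distribʳ-sum (sum g) f) (sum-cong-≋ (λ i → *-distribˡ-sum (f i) g))

  δ : ∀ {n} → Fin n → Fin n → Carrier
  δ i j = if toℕ i ≡ᵇ toℕ j then 1# else 0#

  δ-refl : ∀ {n} (i : Fin n) → δ i i ≈ 1#
  δ-refl i rewrite ≡ᵇ-true {toℕ i} ≡.refl = refl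

  δ-≢ : ∀ {n} {i j : Fin n} → i ≢ j → δ i j ≈ 0#
  δ-≢ {i = i} {j} i≢j rewrite ≡ᵇ-false (i≢j ∘ toℕ-injective) = refl

  δ-sym : ∀ {n} (i j : Fin n) → δ i j ≈ δ j i
  δ-sym i j with i Fin.≟ j
  ... | yes ≡.refl = refl
  ... | no  i≢j    = trans (δ-≢ i≢j) (sym (δ-≢ (i≢j ∘ ≡.sym)))

  δ-injective : ∀ {m n} (f : Fin m → Fin n) → (∀ {x y} → f x ≡ f y → x ≡ y) →
                ∀ x y → δ (f x) (f y) ≈ δ x y
  δ-injective f f-inj x y with x Fin.≟ y
  ... | yes ≡.refl = trans (δ-refl (f x)) (sym (δ-refl x))
  ... | no  x≢y    = trans (δ-≢ (x≢y ∘ f-inj)) (sym (δ-≢ x≢y))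

  sum-δˡ : ∀ {n} (i : Fin n) (f : Fin n → Carrier) → sum (λ l → δ i l * f l) ≈ f i
  sum-δˡ i f = trans (sum-supported i (λ l l≢i → trans (*-congʳ (δ-≢ (l≢i ∘ ≡.sym))) (zeroˡ _)))
                     (trans (*-congʳ (δ-refl i)) (*-identityˡ _))

  sum-δʳ : ∀ {n} (i : Fin n) (f : Fin n → Carrier) → sum (λ l → f l * δ l i) ≈ f i
  sum-δʳ i f = trans (sum-cong-≋ (λ l → trans (*-comm (f l) (δ l i)) (*-congʳ (δ-sym l i)))) (sum-δˡ i f)

  sum-δ-hit : ∀ {k n} (f : Fin k → Fin n) → (∀ {x y} → f x ≡ f y → x ≡ y) →
              ∀ {t J} → f t ≡ J → sum (λ u → δ (f u) J) ≈ 1#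
  sum-δ-hit f f-inj {t} ≡.refl =
    trans (sum-supported t (λ u u≢t → δ-≢ (u≢t ∘ f-inj))) (δ-refl (f t))

  sum-δ-miss : ∀ {k n} (f : Fin k → Fin n) {J} → (∀ t → f t ≢ J) → sum (λ u → δ (f u) J) ≈ 0#
  sum-δ-miss f ft≢J = sum-zero (λ u → δ-≢ (ft≢J u))

  δ-combine : ∀ {m n} (i i' : Fin m) (j j' : Fin n) →
              δ (combine {m} {n} i j) (combine i' j') ≈ δ i i' * δ j j'
  δ-combine i i' j j' with i Fin.≟ i' | j Fin.≟ j'
  ... | yes ≡.refl | yes ≡.refl =
    trans (δ-refl (combine i j)) (sym (trans (*-cong (δ-refl i) (δ-refl j)) (*-identityˡ 1#)))
  ... | no  i≢i'   | _          =
    trans (δ-≢ (i≢i' ∘ combine-injectiveˡ i j i' j')) (sym (trans (*-congʳ (δ-≢ i≢i')) (zeroˡ _)))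
  ... | yes _      | no  j≢j'   =
    trans (δ-≢ (j≢j' ∘ combine-injectiveʳ i j i' j')) (sym (trans (*-congˡ (δ-≢ j≢j')) (zeroʳ _)))

  Matrix : ℕ → ℕ → Set c
  Matrix a b = Fin a → Fin b → Carrier

  infix 4 _≋_
  _≋_ : ∀ {a b} → Matrix a b → Matrix a b → Set ℓ
  A ≋ B = ∀ i j → A i j ≈ B i j

  ≋-setoid : ℕ → ℕ → Setoid c ℓ
  ≋-setoid a b = record
    { Carrier       = Matrix a b
    ; _≈_           = _≋_
    ; isEquivalence = record
      { refl  = λ i j → refl
      ; sym   = λ A≋B i j → sym (A≋B i j)
      ; trans = λ A≋B B≋C i j → trans (A≋B i j) (B≋C i j)
      }
    }

  module ≋-Reasoning {a b : ℕ} where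
    open import Relation.Binary.Reasoning.Setoid (≋-setoid a b) public
    open Setoid (≋-setoid a b) public using () renaming (refl to ≋-refl; sym to ≋-sym; trans to ≋-trans)

  open ≋-Reasoning using (≋-refl; ≋-sym; ≋-trans)

  infixl 7 _·_
  _·_ : ∀ {a b d} → Matrix a b → Matrix b d → Matrix a d
  (A · B) i j = sum (λ l → A i l * B l j)

  I : ∀ {n} → Matrix n n
  I = δ

  ·-cong : ∀ {a b d} {A A' : Matrix a b} {B B' : Matrix b d} → A ≋ A' → B ≋ B' → A · B ≋ A' · B'
  ·-cong A≋A' B≋B' i j = sum-cong-≋ (λ l → *-cong (A≋A' i l) (B≋B' l j))

  ·-congˡ : ∀ {a b d} (A : Matrix a b) {B B' : Matrix b d} → B ≋ B' → A · B ≋ A · B'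
  ·-congˡ A = ·-cong {A = A} ≋-refl

  ·-congʳ : ∀ {a b d} {A A' : Matrix a b} (B : Matrix b d) → A ≋ A' → A · B ≋ A' · B
  ·-congʳ B A≋A' = ·-cong {B = B} A≋A' ≋-refl

  ·-assoc : ∀ {a b d e} (A : Matrix a b) (B : Matrix b d) (C : Matrix d e) → (A · B) · C ≋ A · (B · C)
  ·-assoc A B C i j = begin
    sum (λ l → sum (λ q → A i q * B q l) * C l j)
      ≈⟨ sum-cong-≋ (λ l → *-distribʳ-sum (C l j) (λ q → A i q * B q l)) ⟩
    sum (λ l → sum (λ q → A i q * B q l * C l j))
      ≈⟨ ∑-comm (λ l q → A i q * B q l * C l j) ⟩
    sum (λ q → sum (λ l → A i q * B q l * C l j))
      ≈⟨ sum-cong-≋ (λ q → sum-cong-≋ (λ l → *-assoc (A i q) (B q l) (C l j))) ⟩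
    sum (λ q → sum (λ l → A i q * (B q l * C l j)))
      ≈⟨ sum-cong-≋ (λ q → *-distribˡ-sum (A i q) (λ l → B q l * C l j)) ⟨
    sum (λ q → A i q * sum (λ l → B q l * C l j)) ∎
    where open ≈-Reasoning

  ·-identityˡ : ∀ {a b} (A : Matrix a b) → I · A ≋ A
  ·-identityˡ A i j = sum-δˡ i (λ l → A l j)

  ·-identityʳ : ∀ {a b} (A : Matrix a b) → A · I ≋ A
  ·-identityʳ A i j = sum-δʳ j (A i)

  ·-zeroRow : ∀ {a b d} (A : Matrix a b) (B : Matrix b d) {i} →
              (∀ l → A i l ≈ 0#) → ∀ j → (A · B) i j ≈ 0#
  ·-zeroRow A B A≈0 j = sum-zero (λ l → trans (*-congʳ (A≈0 l)) (zeroˡ _))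

  record Invertible {n} (A : Matrix n n) : Set (c ⊔ ℓ) where
    constructor invertible
    field
      inverse  : Matrix n n
      inverseʳ : A · inverse ≋ I
      inverseˡ : inverse · A ≋ I

  Invertible-I : ∀ {n} → Invertible {n} I
  Invertible-I = invertible I (·-identityˡ I) (·-identityˡ I)

  Invertible-cong : ∀ {n} {A A' : Matrix n n} → A ≋ A' → Invertible A → Invertible A'
  Invertible-cong A≋A' (invertible B AB≋I BA≋I) =
    invertible B (≋-trans (·-congʳ B (≋-sym A≋A')) AB≋I) (≋-trans (·-congˡ B (≋-sym A≋A')) BA≋I)

  Invertible-inverse : ∀ {n} {A : Matrix n n} → (A-inv : Invertible A) → Invertible (Invertible.inverse A-inv)
  Invertible-inverse {A = A} (invertible B AB≋I BA≋I) = invertible A BA≋I AB≋I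

  ·-sandwich : ∀ {a a' b' b} (P : Matrix a a') (P' : Matrix a' b') (A : Matrix b' b)
               {d' d} (Q' : Matrix b d') (Q : Matrix d' d) →
               P · (P' · A · Q') · Q ≋ (P · P') · A · (Q' · Q)
  ·-sandwich P P' A Q' Q = begin
    P · (P' · A · Q') · Q     ≈⟨ ·-congʳ Q (·-assoc P (P' · A) Q') ⟨
    P · (P' · A) · Q' · Q     ≈⟨ ·-congʳ Q (·-congʳ Q' (·-assoc P P' A)) ⟨
    P · P' · A · Q' · Q       ≈⟨ ·-assoc (P · P' · A) Q' Q ⟩
    (P · P') · A · (Q' · Q)   ∎
    where open ≋-Reasoning

  ·-unsandwich : ∀ {a b} {P P' : Matrix a a} {Q Q' : Matrix b b} (A : Matrix a b) →
                 P' · P ≋ I → Q · Q' ≋ I → P' · (P · A · Q) · Q' ≋ A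
  ·-unsandwich {P = P} {P'} {Q} {Q'} A P'P≋I QQ'≋I = begin
    P' · (P · A · Q) · Q'   ≈⟨ ·-sandwich P' P A Q Q' ⟩
    (P' · P) · A · (Q · Q') ≈⟨ ·-cong (·-congʳ A P'P≋I) QQ'≋I ⟩
    I · A · I               ≈⟨ ·-identityʳ (I · A) ⟩
    I · A                   ≈⟨ ·-identityˡ A ⟩
    A                       ∎
    where open ≋-Reasoning

  ·-cancelˡ : ∀ {a b} {P' P : Matrix a a} (A : Matrix a b) → P' · P ≋ I → P' · (P · A) ≋ A
  ·-cancelˡ {P' = P'} {P} A P'P≋I = begin
    P' · (P · A)   ≈⟨ ·-assoc P' P A ⟨
    P' · P · A     ≈⟨ ·-congʳ A P'P≋I ⟩
    I · A          ≈⟨ ·-identityˡ A ⟩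
    A              ∎
    where open ≋-Reasoning

  ·-cancel-inner : ∀ {a b d e} (A : Matrix a b) {B : Matrix b d} {B' : Matrix d b} (C : Matrix b e) →
                   B · B' ≋ I → (A · B) · (B' · C) ≋ A · C
  ·-cancel-inner A {B} {B'} C BB'≋I = begin
    (A · B) · (B' · C)   ≈⟨ ·-assoc A B (B' · C) ⟩
    A · (B · (B' · C))   ≈⟨ ·-congˡ A (·-assoc B B' C) ⟨
    A · ((B · B') · C)   ≈⟨ ·-congˡ A (·-congʳ C BB'≋I) ⟩
    A · (I · C)          ≈⟨ ·-congˡ A (·-identityˡ C) ⟩
    A · C                ∎
    where open ≋-Reasoning

  Invertible-· : ∀ {n} {A B : Matrix n n} → Invertible A → Invertible B → Invertible (A · B)
  Invertible-· {A = A} {B} (invertible A' AA'≋I A'A≋I) (invertible B' BB'≋I B'B≋I) =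
    invertible (B' · A')
      (≋-trans (·-cancel-inner A {B} {B'} A' BB'≋I) AA'≋I)
      (≋-trans (·-cancel-inner B' {A'} {A} B A'A≋I) B'B≋I)

  _ᵀ : ∀ {a b} → Matrix a b → Matrix b a
  (A ᵀ) i j = A j i

  ᵀ-· : ∀ {a b d} (A : Matrix a b) (B : Matrix b d) → (A · B) ᵀ ≋ B ᵀ · A ᵀ
  ᵀ-· A B i j = sum-cong-≋ (λ l → *-comm (A j l) (B l i))

  Invertible-ᵀ : ∀ {n} {A : Matrix n n} → Invertible A → Invertible (A ᵀ)
  Invertible-ᵀ {A = A} (invertible B AB≋I BA≋I) = invertible (B ᵀ)
    (λ i j → trans (sym (ᵀ-· B A i j)) (trans (BA≋I j i) (δ-sym j i)))
    (λ i j → trans (sym (ᵀ-· A B i j)) (trans (AB≋I j i) (δ-sym j i)))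

  infixr 8 _◃_
  _◃_ : ∀ {a b} → Carrier → Matrix a b → Matrix a b
  (x ◃ A) i j = x * A i j

  ◃-· : ∀ {a b d} (x : Carrier) (A : Matrix a b) (B : Matrix b d) → (x ◃ A) · B ≋ x ◃ (A · B)
  ◃-· x A B i j =
    trans (sum-cong-≋ (λ l → *-assoc x (A i l) (B l j))) (sym (*-distribˡ-sum x (λ l → A i l * B l j)))

  ·-◃ : ∀ {a b d} (x : Carrier) (A : Matrix a b) (B : Matrix b d) → A · (x ◃ B) ≋ x ◃ (A · B)
  ·-◃ x A B i j = trans (sum-cong-≋ (λ l → *-x∙yz≈yx∙z (A i l) x (B l j))) (◃-· x A B i j)

  Invertible-◃ : ∀ {n} {x y : Carrier} {A : Matrix n n} → x * y ≈ 1# → Invertible A → Invertible (x ◃ A)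
  Invertible-◃ {x = x} {y} {A} xy≈1 (invertible B AB≋I BA≋I) =
    invertible (y ◃ B) (scaled x y A B xy≈1 AB≋I) (scaled y x B A (trans (*-comm y x) xy≈1) BA≋I)
    where
    scaled : ∀ x y A B → x * y ≈ 1# → A · B ≋ I → (x ◃ A) · (y ◃ B) ≋ I
    scaled x y A B xy≈1 AB≋I i j = begin
      sum (λ l → x * A i l * (y * B l j))   ≈⟨ sum-cong-≋ (λ l → *-interchange x (A i l) y (B l j)) ⟩
      sum (λ l → x * y * (A i l * B l j))   ≈⟨ *-distribˡ-sum (x * y) (λ l → A i l * B l j) ⟨
      x * y * (A · B) i j                   ≈⟨ *-cong xy≈1 (AB≋I i j) ⟩
      1# * δ i j                            ≈⟨ *-identityˡ (δ i j) ⟩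
      δ i j                                 ∎
      where open ≈-Reasoning

  infix 9 I+_
  I+_ : ∀ {n} → Matrix n n → Matrix n n
  (I+ A) i j = δ i j + A i j

  I+-· : ∀ {n} (A B : Matrix n n) → (I+ A) · (I+ B) ≋ I+ (λ i j → A i j + B i j + (A · B) i j)
  I+-· A B i j = begin
    sum (λ l → (δ i l + A i l) * (δ l j + B l j))
      ≈⟨ sum-cong-≋ (λ l → distribʳ (δ l j + B l j) (δ i l) (A i l)) ⟩
    sum (λ l → δ i l * (δ l j + B l j) + A i l * (δ l j + B l j))
      ≈⟨ ∑-distrib-+ (λ l → δ i l * (δ l j + B l j)) (λ l → A i l * (δ l j + B l j)) ⟩
    sum (λ l → δ i l * (δ l j + B l j)) + sum (λ l → A i l * (δ l j + B l j))
      ≈⟨ +-cong (sum-δˡ i (λ l → δ l j + B l j)) (sum-cong-≋ (λ l → distribˡ (A i l) (δ l j) (B l j))) ⟩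
    (δ i j + B i j) + sum (λ l → A i l * δ l j + A i l * B l j)
      ≈⟨ +-congˡ (∑-distrib-+ (λ l → A i l * δ l j) (λ l → A i l * B l j)) ⟩
    (δ i j + B i j) + (sum (λ l → A i l * δ l j) + (A · B) i j)
      ≈⟨ +-congˡ (+-congʳ (sum-δʳ j (A i))) ⟩
    (δ i j + B i j) + (A i j + (A · B) i j)
      ≈⟨ +-assoc (δ i j) (B i j) _ ⟩
    δ i j + (B i j + (A i j + (A · B) i j))
      ≈⟨ +-congˡ (+-x∙yz≈yx∙z (B i j) (A i j) ((A · B) i j)) ⟩
    δ i j + (A i j + B i j + (A · B) i j) ∎
    where open ≈-Reasoning

  I+-·-cancel : ∀ {n} {A B : Matrix n n} → (∀ i j → A i j + B i j + (A · B) i j ≈ 0#) → (I+ A) · (I+ B) ≋ I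
  I+-·-cancel {A = A} {B} A+B+AB≈0 i j = trans (I+-· A B i j) (trans (+-congˡ (A+B+AB≈0 i j)) (+-identityʳ (δ i j)))

  Invertible-I+nilpotent : ∀ {n} {E : Matrix n n} → E · E ≋ (λ _ _ → 0#) → Invertible (I+ E)
  Invertible-I+nilpotent {E = E} E²≋0 = invertible (I+ ((- 1#) ◃ E))
    (I+-·-cancel (λ i j → +-absorbs (+-congˡ (-1*x≈-x (E i j))) (-‿inverseʳ (E i j))
                                   (trans (·-◃ (- 1#) E E i j) (scaled0 i j))))
    (I+-·-cancel (λ i j → +-absorbs (+-congʳ (-1*x≈-x (E i j))) (-‿inverseˡ (E i j))
                                   (trans (◃-· (- 1#) E E i j) (scaled0 i j))))
    where
    scaled0 : ∀ i j → - 1# * (E · E) i j ≈ 0#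
    scaled0 i j = trans (*-congˡ (E²≋0 i j)) (zeroʳ (- 1#))
    +-absorbs : ∀ {x x' y} → x ≈ x' → x' ≈ 0# → y ≈ 0# → x + y ≈ 0#
    +-absorbs x≈x' x'≈0 y≈0 = trans (+-cong (trans x≈x' x'≈0) y≈0) (+-identityˡ 0#)

  record Equivalent {a b} (A M : Matrix a b) : Set (c ⊔ ℓ) where
    constructor equivalent
    field
      P            : Matrix a a
      Q            : Matrix b b
      P-invertible : Invertible P
      Q-invertible : Invertible Q
      M≋PAQ        : M ≋ P · A · Q

  ≋⇒Equivalent : ∀ {a b} {A M : Matrix a b} → A ≋ M → Equivalent A M
  ≋⇒Equivalent {A = A} A≋M = equivalent I I Invertible-I Invertible-I
    (≋-sym (≋-trans (·-identityʳ (I · A)) (≋-trans (·-identityˡ A) A≋M)))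

  Equivalent-sym : ∀ {a b} {A M : Matrix a b} → Equivalent A M → Equivalent M A
  Equivalent-sym {A = A} (equivalent P Q (invertible P' PP'≋I P'P≋I) (invertible Q' QQ'≋I Q'Q≋I) M≋PAQ) =
    equivalent P' Q' (invertible P P'P≋I PP'≋I) (invertible Q Q'Q≋I QQ'≋I)
    (≋-sym (≋-trans (·-congʳ Q' (·-congˡ P' M≋PAQ)) (·-unsandwich A P'P≋I QQ'≋I)))

  Equivalent-trans : ∀ {a b} {A B M : Matrix a b} → Equivalent A B → Equivalent B M → Equivalent A M
  Equivalent-trans {A = A} (equivalent P Q P-inv Q-inv B≋PAQ) (equivalent P' Q' P'-inv Q'-inv M≋P'BQ') =
    equivalent (P' · P) (Q · Q') (Invertible-· P'-inv P-inv) (Invertible-· Q-inv Q'-inv)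
    (≋-trans M≋P'BQ' (≋-trans (·-congʳ Q' (·-congˡ P' B≋PAQ)) (·-sandwich P' P A Q Q')))

  permutationMatrix : ∀ {n} → Permutation′ n → Matrix n n
  permutationMatrix π i j = δ (π ⟨$⟩ʳ i) j

  permutationMatrix-· : ∀ {n b} (π : Permutation′ n) (A : Matrix n b) →
                        permutationMatrix π · A ≋ λ i j → A (π ⟨$⟩ʳ i) j
  permutationMatrix-· π A i j = sum-δˡ (π ⟨$⟩ʳ i) (λ l → A l j)

  Invertible-permutationMatrix : ∀ {n} (π : Permutation′ n) → Invertible (permutationMatrix π)
  Invertible-permutationMatrix π = invertible (permutationMatrix (Perm.flip π))
    (λ i j → trans (permutationMatrix-· π (permutationMatrix (Perm.flip π)) i j)
                   (reflexive (≡.cong (λ k → δ k j) (Perm.inverseˡ π))))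
    (λ i j → trans (permutationMatrix-· (Perm.flip π) (permutationMatrix π) i j)
                   (reflexive (≡.cong (λ k → δ k j) (Perm.inverseʳ π))))

  ·-permutationMatrixᵀ : ∀ {a n} (π : Permutation′ n) (A : Matrix a n) →
                         A · permutationMatrix π ᵀ ≋ λ i j → A i (π ⟨$⟩ʳ j)
  ·-permutationMatrixᵀ π A i j =
    trans (sum-cong-≋ (λ l → *-congˡ (δ-sym (π ⟨$⟩ʳ j) l))) (sum-δʳ (π ⟨$⟩ʳ j) (A i))

  Equivalent-permute : ∀ {a b} (π : Permutation′ a) (σ : Permutation′ b) (M : Matrix a b) →
                       Equivalent (λ i j → M (π ⟨$⟩ʳ i) (σ ⟨$⟩ʳ j)) M
  Equivalent-permute π σ M =
    equivalent (permutationMatrix (Perm.flip π)) (permutationMatrix (Perm.flip σ) ᵀ)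
      (Invertible-permutationMatrix (Perm.flip π)) (Invertible-ᵀ (Invertible-permutationMatrix (Perm.flip σ)))
    λ i j → sym (begin
      (permutationMatrix (Perm.flip π) · M' · permutationMatrix (Perm.flip σ) ᵀ) i j
        ≈⟨ ·-permutationMatrixᵀ (Perm.flip σ) (permutationMatrix (Perm.flip π) · M') i j ⟩
      (permutationMatrix (Perm.flip π) · M') i (σ ⟨$⟩ˡ j)
        ≈⟨ permutationMatrix-· (Perm.flip π) M' i (σ ⟨$⟩ˡ j) ⟩
      M (π ⟨$⟩ʳ (π ⟨$⟩ˡ i)) (σ ⟨$⟩ʳ (σ ⟨$⟩ˡ j))
        ≡⟨ ≡.cong₂ M (Perm.inverseʳ π) (Perm.inverseʳ σ) ⟩
      M i j ∎)
    where
    open ≈-Reasoning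
    M' = λ i j → M (π ⟨$⟩ʳ i) (σ ⟨$⟩ʳ j)

  +-absorbs-sum-zero : ∀ {n x y} {f : Fin n → Carrier} → x ≈ y → (∀ l → f l ≈ 0#) → x + sum f ≈ y
  +-absorbs-sum-zero {y = y} x≈y f≈0 = trans (+-cong x≈y (sum-zero f≈0)) (+-identityʳ y)

  zero-+-sum : ∀ {n x y} {f : Fin n → Carrier} → x ≈ 0# → sum f ≈ y → x + sum f ≈ y
  zero-+-sum {y = y} x≈0 Σf≈y = trans (+-cong x≈0 Σf≈y) (+-identityˡ y)

  block : ∀ {m n} → Carrier → (Fin n → Carrier) → (Fin m → Carrier) → Matrix m n → Matrix (suc m) (suc n)
  block a r c S Fin.zero    Fin.zero    = a
  block a r c S Fin.zero    (Fin.suc j) = r j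
  block a r c S (Fin.suc i) Fin.zero    = c i
  block a r c S (Fin.suc i) (Fin.suc j) = S i j

  0ᵛ : ∀ {n} → Fin n → Carrier
  0ᵛ _ = 0#

  infix 9 1⊕_
  1⊕_ : ∀ {m n} → Matrix m n → Matrix (suc m) (suc n)
  1⊕ A = block 1# 0ᵛ 0ᵛ A

  1⊕-cong : ∀ {m n} {A B : Matrix m n} → A ≋ B → 1⊕ A ≋ 1⊕ B
  1⊕-cong A≋B Fin.zero    Fin.zero    = refl
  1⊕-cong A≋B Fin.zero    (Fin.suc j) = refl
  1⊕-cong A≋B (Fin.suc i) Fin.zero    = refl
  1⊕-cong A≋B (Fin.suc i) (Fin.suc j) = A≋B i j

  1⊕-I : ∀ {n} → 1⊕ I ≋ I {suc n}
  1⊕-I Fin.zero    Fin.zero    = refl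
  1⊕-I Fin.zero    (Fin.suc j) = refl
  1⊕-I (Fin.suc i) Fin.zero    = refl
  1⊕-I (Fin.suc i) (Fin.suc j) = refl

  1⊕-· : ∀ {a b d} (A : Matrix a b) (B : Matrix b d) → 1⊕ A · 1⊕ B ≋ 1⊕ (A · B)
  1⊕-· {b = b} A B Fin.zero    Fin.zero    = +-absorbs-sum-zero {b} (*-identityˡ 1#) (λ l → zeroˡ 0#)
  1⊕-· {b = b} A B Fin.zero    (Fin.suc j) = +-absorbs-sum-zero {b} (zeroʳ 1#) (λ l → zeroˡ (B l j))
  1⊕-· {b = b} A B (Fin.suc i) Fin.zero    = +-absorbs-sum-zero {b} (zeroˡ 1#) (λ l → zeroʳ (A i l))
  1⊕-· {b = b} A B (Fin.suc i) (Fin.suc j) = zero-+-sum {b} (zeroˡ 0#) refl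

  Invertible-1⊕ : ∀ {n} {A : Matrix n n} → Invertible A → Invertible (1⊕ A)
  Invertible-1⊕ {A = A} (invertible B AB≋I BA≋I) = invertible (1⊕ B)
    (≋-trans (1⊕-· A B) (≋-trans (1⊕-cong AB≋I) 1⊕-I))
    (≋-trans (1⊕-· B A) (≋-trans (1⊕-cong BA≋I) 1⊕-I))

  Equivalent-1⊕ : ∀ {m n} {A M : Matrix m n} → Equivalent A M → Equivalent (1⊕ A) (1⊕ M)
  Equivalent-1⊕ {A = A} {M} (equivalent P Q P-inv Q-inv M≋PAQ) =
    equivalent (1⊕ P) (1⊕ Q) (Invertible-1⊕ P-inv) (Invertible-1⊕ Q-inv) (begin
      1⊕ M                  ≈⟨ 1⊕-cong M≋PAQ ⟩
      1⊕ (P · A · Q)        ≈⟨ 1⊕-· (P · A) Q ⟨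
      1⊕ (P · A) · 1⊕ Q     ≈⟨ ·-congʳ (1⊕ Q) (1⊕-· P A) ⟨
      1⊕ P · 1⊕ A · 1⊕ Q    ∎)
    where open ≋-Reasoning

  unitRow : ∀ {n} → (Fin n → Carrier) → Matrix (suc n) (suc n)
  unitRow v = block 1# v 0ᵛ I

  unitRow-· : ∀ {n} {u v : Fin n → Carrier} → (∀ j → v j + u j ≈ 0#) → unitRow u · unitRow v ≋ I
  unitRow-· {n} {u} {v} v+u≈0 Fin.zero    Fin.zero    = +-absorbs-sum-zero {n} (*-identityˡ 1#) (λ l → zeroʳ (u l))
  unitRow-· {n} {u} {v} v+u≈0 Fin.zero    (Fin.suc j) = trans (+-cong (*-identityˡ (v j)) (sum-δʳ j u)) (v+u≈0 j)
  unitRow-· {n} {u} {v} v+u≈0 (Fin.suc i) Fin.zero    = +-absorbs-sum-zero {n} (zeroˡ 1#) (λ l → zeroʳ (δ i l))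
  unitRow-· {n} {u} {v} v+u≈0 (Fin.suc i) (Fin.suc j) = zero-+-sum {n} (zeroˡ (v j)) (sum-δˡ i (λ l → δ l j))

  Invertible-unitRow : ∀ {n} (v : Fin n → Carrier) → Invertible (unitRow v)
  Invertible-unitRow v =
    invertible (unitRow (λ j → - v j))
      (unitRow-· (λ j → -‿inverseˡ (v j))) (unitRow-· (λ j → -‿inverseʳ (v j)))

  1⊕-·-unitRow : ∀ {m n} (S : Matrix m n) (v : Fin n → Carrier) → 1⊕ S · unitRow v ≋ block 1# v 0ᵛ S
  1⊕-·-unitRow {m} {n} S v Fin.zero    Fin.zero    = +-absorbs-sum-zero {n} (*-identityˡ 1#) (λ l → zeroˡ 0#)
  1⊕-·-unitRow {m} {n} S v Fin.zero    (Fin.suc j) = +-absorbs-sum-zero {n} (*-identityˡ (v j)) (λ l → zeroˡ (δ l j))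
  1⊕-·-unitRow {m} {n} S v (Fin.suc i) Fin.zero    = +-absorbs-sum-zero {n} (zeroˡ 1#) (λ l → zeroʳ (S i l))
  1⊕-·-unitRow {m} {n} S v (Fin.suc i) (Fin.suc j) = zero-+-sum {n} (zeroˡ (v j)) (sum-δʳ j (S i))

  pivotColumn : ∀ {m} → Carrier → (Fin m → Carrier) → Matrix (suc m) (suc m)
  pivotColumn p c = block p 0ᵛ c I

  pivotColumn-· : ∀ {m} {p p' : Carrier} {c c' : Fin m → Carrier} →
                  p * p' ≈ 1# → (∀ i → c i * p' + c' i ≈ 0#) → pivotColumn p c · pivotColumn p' c' ≋ I
  pivotColumn-· {m} {c' = c'} pp'≈1 cp'+c'≈0 Fin.zero    Fin.zero    = +-absorbs-sum-zero {m} pp'≈1 (λ l → zeroˡ (c' l))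
  pivotColumn-· {m} {p = p}   pp'≈1 cp'+c'≈0 Fin.zero    (Fin.suc j) = +-absorbs-sum-zero {m} (zeroʳ p) (λ l → zeroˡ (δ l j))
  pivotColumn-· {m} {c' = c'} pp'≈1 cp'+c'≈0 (Fin.suc i) Fin.zero    = trans (+-congˡ (sum-δˡ i c')) (cp'+c'≈0 i)
  pivotColumn-· {m} {c = c}   pp'≈1 cp'+c'≈0 (Fin.suc i) (Fin.suc j) = zero-+-sum {m} (zeroʳ (c i)) (sum-δˡ i (λ l → δ l j))

  Invertible-pivotColumn : ∀ {m} {p y : Carrier} (c : Fin m → Carrier) → p * y ≈ 1# → Invertible (pivotColumn p c)
  Invertible-pivotColumn {p = p} {y} c py≈1 =
    invertible (pivotColumn y (λ i → - (y * c i)))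
      (pivotColumn-· py≈1 (λ i → trans (+-congʳ (*-comm (c i) y)) (-‿inverseʳ (y * c i))))
      (pivotColumn-· (trans (*-comm y p) py≈1) (λ i → trans (+-congʳ (-ycp≈-c i)) (-‿inverseˡ (c i))))
    where
    -ycp≈-c : ∀ i → - (y * c i) * p ≈ - c i
    -ycp≈-c i = begin
      - (y * c i) * p   ≈⟨ -‿distribˡ-* (y * c i) p ⟨
      - (y * c i * p)   ≈⟨ -‿cong (*-xy∙z≈y∙xz y (c i) p) ⟩
      - (c i * (y * p)) ≈⟨ -‿cong (*-congˡ (trans (*-comm y p) py≈1)) ⟩
      - (c i * 1#)      ≈⟨ -‿cong (*-identityʳ (c i)) ⟩
      - c i             ∎
      where open ≈-Reasoning

  schur : ∀ {m n} → Matrix (suc m) (suc n) → Carrier → Matrix m n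
  schur M y i j = M (Fin.suc i) (Fin.suc j) - M (Fin.suc i) Fin.zero * (y * M Fin.zero (Fin.suc j))

  module _ {m n : ℕ} (M : Matrix (suc m) (suc n)) {y : Carrier} (py≈1 : M Fin.zero Fin.zero * y ≈ 1#) where

    private
      p : Carrier
      p = M Fin.zero Fin.zero
      col : Fin m → Carrier
      col i = M (Fin.suc i) Fin.zero
      row : Fin n → Carrier
      row j = y * M Fin.zero (Fin.suc j)

    pivotColumn-·-block : pivotColumn p col · block 1# row 0ᵛ (schur M y) ≋ M
    pivotColumn-·-block Fin.zero    Fin.zero    = +-absorbs-sum-zero {m} (*-identityʳ p) (λ l → zeroˡ 0#)
    pivotColumn-·-block Fin.zero    (Fin.suc j) = +-absorbs-sum-zero {m} pv≈r (λ l → zeroˡ (schur M y l j))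
      where
      pv≈r : p * (y * M Fin.zero (Fin.suc j)) ≈ M Fin.zero (Fin.suc j)
      pv≈r = trans (sym (*-assoc p y _)) (trans (*-congʳ py≈1) (*-identityˡ _))
    pivotColumn-·-block (Fin.suc i) Fin.zero    = +-absorbs-sum-zero {m} (*-identityʳ (col i)) (λ l → zeroʳ (δ i l))
    pivotColumn-·-block (Fin.suc i) (Fin.suc j) =
      trans (+-congˡ (sum-δˡ i (λ l → schur M y l j))) (trans (sym (+-assoc _ _ _)) (xyx⁻¹≈y _ _))

    pivot-factorisation : M ≋ pivotColumn p col · 1⊕ schur M y · unitRow row
    pivot-factorisation = ≋-sym (begin
      pivotColumn p col · 1⊕ schur M y · unitRow row
        ≈⟨ ·-assoc (pivotColumn p col) (1⊕ schur M y) (unitRow row) ⟩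
      pivotColumn p col · (1⊕ schur M y · unitRow row)
        ≈⟨ ·-congˡ (pivotColumn p col) (1⊕-·-unitRow (schur M y) row) ⟩
      pivotColumn p col · block 1# row 0ᵛ (schur M y)
        ≈⟨ pivotColumn-·-block ⟩
      M ∎)
      where open ≋-Reasoning

    Equivalent-pivot : Equivalent (1⊕ schur M y) M
    Equivalent-pivot = equivalent (pivotColumn p col) (unitRow row)
      (Invertible-pivotColumn col py≈1) (Invertible-unitRow row) pivot-factorisation

  idBlock : ∀ {a b} → ℕ → Matrix a b
  idBlock                 zero    i        j        = 0#
  idBlock {suc a} {suc b} (suc k) i        j        = (1⊕ idBlock k) i j
  idBlock {zero}          (suc k) ()       j
  idBlock {suc a} {zero}  (suc k) i        ()

  idBlock-zeroRow : ∀ {a b} k (i : Fin a) (j : Fin b) → k ≤ toℕ i → idBlock k i j ≈ 0#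
  idBlock-zeroRow                 zero    i           j           _         = refl
  idBlock-zeroRow {suc a} {suc b} (suc k) (Fin.suc i) Fin.zero    _         = refl
  idBlock-zeroRow {suc a} {suc b} (suc k) (Fin.suc i) (Fin.suc j) (s≤s k≤i) = idBlock-zeroRow k i j k≤i

  idBlock-inject≤ : ∀ {a b} k (k≤a : k ≤ a) (k≤b : k ≤ b) (t t' : Fin k) →
                    idBlock k (inject≤ t k≤a) (inject≤ t' k≤b) ≈ δ t t'
  idBlock-inject≤ {suc a} {suc b} (suc k) k≤a k≤b Fin.zero    Fin.zero     = refl
  idBlock-inject≤ {suc a} {suc b} (suc k) k≤a k≤b Fin.zero    (Fin.suc t') = refl
  idBlock-inject≤ {suc a} {suc b} (suc k) k≤a k≤b (Fin.suc t) Fin.zero     = refl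
  idBlock-inject≤ {suc a} {suc b} (suc k) k≤a k≤b (Fin.suc t) (Fin.suc t') =
    idBlock-inject≤ k (ℕ.≤-pred k≤a) (ℕ.≤-pred k≤b) t t'

  idBlock-factor : ∀ {a b} k → idBlock {a} {b} k ≋ idBlock {a} {k} k · idBlock {k} {b} k
  idBlock-factor                 zero    i  j  = refl
  idBlock-factor {suc a} {suc b} (suc k)       =
    ≋-trans (1⊕-cong (idBlock-factor k)) (≋-sym (1⊕-· (idBlock k) (idBlock k)))
  idBlock-factor {zero}          (suc k) ()
  idBlock-factor {suc a} {zero}  (suc k) i  ()

  Equivalent-idBlock-zero : ∀ {a b} {M : Matrix a b} → Equivalent (idBlock 0) M → ∀ i j → M i j ≈ 0#
  Equivalent-idBlock-zero (equivalent P Q _ _ M≋P0Q) i j =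
    trans (M≋P0Q i j) (sum-zero (λ l → trans (*-congʳ (sum-zero (λ q → zeroʳ (P i q)))) (zeroˡ (Q l j))))

  kron : ∀ {m n} → Matrix m m → Matrix n n → Matrix (m ℕ.* n) (m ℕ.* n)
  kron {m} {n} h g a b =
    h (proj₁ (remQuot {m} n a)) (proj₁ (remQuot {m} n b))
      * g (proj₂ (remQuot {m} n a)) (proj₂ (remQuot {m} n b))

  kron-combine : ∀ {m n} (h : Matrix m m) (g : Matrix n n) i j i' j' →
                 kron h g (combine i j) (combine i' j') ≡ h i i' * g j j'
  kron-combine {m} {n} h g i j i' j' =
    ≡.cong₂ (λ x y → h (proj₁ x) (proj₁ y) * g (proj₂ x) (proj₂ y))
            (remQuot-combine {m} {n} i j) (remQuot-combine {m} {n} i' j')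

  ≈-combine : ∀ {m n} {u v : Fin (m ℕ.* n) → Carrier} →
              (∀ i j → u (combine {m} {n} i j) ≈ v (combine i j)) → ∀ x → u x ≈ v x
  ≈-combine {m} {n} {u} {v} u≈v x =
    ≡.subst (λ y → u y ≈ v y) (combine-remQuot {m} n x) (uncurry u≈v (remQuot {m} n x))

  ≋-combine : ∀ {m n} {A B : Matrix (m ℕ.* n) (m ℕ.* n)} →
              (∀ i j i' j' → A (combine {m} {n} i j) (combine i' j') ≈ B (combine i j) (combine i' j')) → A ≋ B
  ≋-combine {m} {n} A≈B x y = ≈-combine {m} {n} (λ i j → ≈-combine {m} {n} (λ i' j' → A≈B i j i' j') y) x

  kron-· : ∀ {m n} (h h' : Matrix m m) (g g' : Matrix n n) → kron h g · kron h' g' ≋ kron (h · h') (g · g')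
  kron-· {m} {n} h h' g g' = ≋-combine {m} {n} λ i j i' j' → begin
    sum (λ x → kron h g (combine i j) x * kron h' g' x (combine i' j'))
      ≈⟨ sum-combine {m} {n} (λ x → kron h g (combine i j) x * kron h' g' x (combine i' j')) ⟩
    ∑[ p < m ] ∑[ q < n ] (kron h g (combine i j) (combine p q) * kron h' g' (combine p q) (combine i' j'))
      ≈⟨ sum-cong-≋ {m} (λ p → sum-cong-≋ {n} (λ q →
           reflexive (≡.cong₂ _*_ (kron-combine h g i j p q) (kron-combine h' g' p q i' j')))) ⟩
    ∑[ p < m ] ∑[ q < n ] ((h i p * g j q) * (h' p i' * g' q j'))
      ≈⟨ sum-cong-≋ {m} (λ p → sum-cong-≋ {n} (λ q → *-interchange (h i p) (g j q) (h' p i') (g' q j'))) ⟩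
    ∑[ p < m ] ∑[ q < n ] ((h i p * h' p i') * (g j q * g' q j'))
      ≈⟨ sum-product (λ p → h i p * h' p i') (λ q → g j q * g' q j') ⟨
    (h · h') i i' * (g · g') j j'
      ≡⟨ kron-combine (h · h') (g · g') i j i' j' ⟨
    kron (h · h') (g · g') (combine i j) (combine i' j') ∎
    where open ≈-Reasoning

  kron-I : ∀ {m n} → kron {m} {n} I I ≋ I
  kron-I {m} {n} = ≋-combine {m} {n} λ i j i' j' →
    trans (reflexive (kron-combine I I i j i' j')) (sym (δ-combine i i' j j'))

  kron-cong : ∀ {m n} {h h' : Matrix m m} {g g' : Matrix n n} → h ≋ h' → g ≋ g' → kron h g ≋ kron h' g'
  kron-cong h≋h' g≋g' x y = *-cong (h≋h' _ _) (g≋g' _ _)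

  Invertible-kron : ∀ {m n} {h : Matrix m m} {g : Matrix n n} → Invertible h → Invertible g → Invertible (kron h g)
  Invertible-kron {m} {n} {h} {g} (invertible h' hh'≋I h'h≋I) (invertible g' gg'≋I g'g≋I) =
    invertible (kron h' g')
      (≋-trans (kron-· h h' g g') (≋-trans (kron-cong hh'≋I gg'≋I) (kron-I {m} {n})))
      (≋-trans (kron-· h' h g' g) (≋-trans (kron-cong h'h≋I g'g≋I) (kron-I {m} {n})))

  reshape : ∀ {m n} → (Fin (m ℕ.* n) → Carrier) → Matrix m n
  reshape v i j = v (combine i j)

  reshape-·kron : ∀ {m n} (v : Fin (m ℕ.* n) → Carrier) (h : Matrix m m) (g : Matrix n n) →
                  reshape (λ y → sum (λ x → v x * kron h g x y)) ≋ h ᵀ · reshape v · g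
  reshape-·kron {m} {n} v h g i' j' = begin
    sum (λ x → v x * kron h g x (combine i' j'))
      ≈⟨ sum-combine {m} {n} (λ x → v x * kron h g x (combine i' j')) ⟩
    ∑[ i < m ] ∑[ j < n ] (v (combine i j) * kron h g (combine i j) (combine i' j'))
      ≈⟨ sum-cong-≋ {m} (λ i → sum-cong-≋ {n} (λ j → *-congˡ (reflexive (kron-combine h g i j i' j')))) ⟩
    ∑[ i < m ] ∑[ j < n ] (v (combine i j) * (h i i' * g j j'))
      ≈⟨ ∑-comm (λ i j → v (combine i j) * (h i i' * g j j')) ⟩
    ∑[ j < n ] ∑[ i < m ] (v (combine i j) * (h i i' * g j j'))
      ≈⟨ sum-cong-≋ {n} (λ j → sum-cong-≋ {m} (λ i → *-x∙yz≈yx∙z (v (combine i j)) (h i i') (g j j'))) ⟩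
    ∑[ j < n ] ∑[ i < m ] (h i i' * v (combine i j) * g j j')
      ≈⟨ sum-cong-≋ {n} (λ j → *-distribʳ-sum (g j j') (λ i → h i i' * v (combine i j))) ⟨
    (h ᵀ · reshape v · g) i' j' ∎
    where
    open ≈-Reasoning

record IsDiscreteField {c ℓ : Level} (R : CommutativeRing c ℓ) : Set (c ⊔ ℓ) where
  open CommutativeRing R
  field
    0≉1     : ¬ 0# ≈ 1#
    inverse : ∀ x → ¬ x ≈ 0# → ∃ λ y → x * y ≈ 1#
    ≈0?     : ∀ x → Dec (x ≈ 0#)

module Rank {c ℓ : Level} (R : CommutativeRing c ℓ) (isDiscreteField : IsDiscreteField R) where

  open CommutativeRing R
  open IsDiscreteField isDiscreteField
  open Matrices R
  open ≋-Reasoning using (≋-refl; ≋-sym; ≋-trans)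

  zeroRow⇒¬rightInverse : ∀ {a b} {A : Matrix a b} {B : Matrix b a} {i} →
                          (∀ l → A i l ≈ 0#) → ¬ (A · B ≋ I)
  zeroRow⇒¬rightInverse {A = A} {B} {i} Ai≈0 AB≋I =
    0≉1 (trans (sym (·-zeroRow A B Ai≈0 i)) (trans (AB≋I i i) (δ-refl i)))

  zero⊎nonzero : ∀ {a b} (M : Matrix a b) → (∀ i j → M i j ≈ 0#) ⊎ ∃₂ λ i j → ¬ M i j ≈ 0#
  zero⊎nonzero {a} {b} M with all? (λ i → all? (λ j → ≈0? (M i j)))
  ... | yes M≈0 = inj₁ M≈0
  ... | no  M≉0 with ¬∀⟶∃¬ a _ (λ i → all? (λ j → ≈0? (M i j))) M≉0
  ...   | i , Mi≉0 with ¬∀⟶∃¬ b _ (λ j → ≈0? (M i j)) Mi≉0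
  ...     | j , Mij≉0 = inj₂ (i , j , Mij≉0)

  swapToCorner : ∀ {m n} → Matrix (suc m) (suc n) → Fin (suc m) → Fin (suc n) → Matrix (suc m) (suc n)
  swapToCorner M i₀ j₀ i j = M (transpose Fin.zero i₀ ⟨$⟩ʳ i) (transpose Fin.zero j₀ ⟨$⟩ʳ j)

  normalForm : ∀ {m n} (M : Matrix m n) → ∃ λ k → k ≤ m × k ≤ n × Equivalent (idBlock k) M
  normalForm {zero}          M = 0 , z≤n , z≤n , ≋⇒Equivalent (λ ())
  normalForm {suc m} {zero}  M = 0 , z≤n , z≤n , ≋⇒Equivalent (λ i ())
  normalForm {suc m} {suc n} M with zero⊎nonzero M
  ... | inj₁ M≈0 = 0 , z≤n , z≤n , ≋⇒Equivalent (λ i j → sym (M≈0 i j))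
  ... | inj₂ (i₀ , j₀ , Mi₀j₀≉0) with inverse (M i₀ j₀) Mi₀j₀≉0
  ... | y , py≈1 with normalForm (schur (swapToCorner M i₀ j₀) y)
  ... | k , k≤m , k≤n , D~S = suc k , s≤s k≤m , s≤s k≤n ,
    Equivalent-trans (Equivalent-trans (Equivalent-1⊕ D~S) (Equivalent-pivot (swapToCorner M i₀ j₀) py≈1))
                     (Equivalent-permute (transpose Fin.zero i₀) (transpose Fin.zero j₀) M)

  -- A = P (idBlock k) Q with k ≤ q; if k < p then row k of P⁻¹ = idBlock k · Q B vanishes.
  identity-factorisation⇒≤ : ∀ {p q} (A : Matrix p q) (B : Matrix q p) → I ≋ A · B → p ≤ q
  identity-factorisation⇒≤ {p} {q} A B I≋AB with normalForm A
  ... | k , k≤p , k≤q , equivalent P Q (invertible P' _ P'P≋I) _ A≋PDQ with p ℕ.≤? k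
  ...   | yes p≤k = ℕ.≤-trans p≤k k≤q
  ...   | no  p≰k = contradiction P'P≋I (zeroRow⇒¬rightInverse {B = P} P'i₀≈0)
    where
    i₀ : Fin p
    i₀ = fromℕ< (ℕ.≰⇒> p≰k)
    P'≋D·QB : P' ≋ idBlock k · (Q · B)
    P'≋D·QB = begin
      P'                               ≈⟨ ·-identityʳ P' ⟨
      P' · I                           ≈⟨ ·-congˡ P' I≋AB ⟩
      P' · (A · B)                     ≈⟨ ·-congˡ P' (·-congʳ B A≋PDQ) ⟩
      P' · (P · idBlock k · Q · B)     ≈⟨ ·-congˡ P' (·-assoc (P · idBlock k) Q B) ⟩
      P' · (P · idBlock k · (Q · B))   ≈⟨ ·-congˡ P' (·-assoc P (idBlock k) (Q · B)) ⟩
      P' · (P · (idBlock k · (Q · B))) ≈⟨ ·-cancelˡ (idBlock k · (Q · B)) P'P≋I ⟩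
      idBlock k · (Q · B)              ∎
      where open ≋-Reasoning
    P'i₀≈0 : ∀ l → P' i₀ l ≈ 0#
    P'i₀≈0 l = trans (P'≋D·QB i₀ l) (·-zeroRow (idBlock k) (Q · B) Di₀≈0 l)
      where
      Di₀≈0 : ∀ l → idBlock k i₀ l ≈ 0#
      Di₀≈0 l = idBlock-zeroRow k i₀ l (ℕ.≤-reflexive (≡.sym (toℕ-fromℕ< (ℕ.≰⇒> p≰k))))

  IdentityMinor : ∀ {a b} → ℕ → Matrix a b → Set ℓ
  IdentityMinor {a} {b} s M =
    ∃₂ λ (ρ : Fin s → Fin a) (σ : Fin s → Fin b) → ∀ t t' → M (ρ t) (σ t') ≈ δ t t'

  FactorsThrough : ∀ {a b} → ℕ → Matrix a b → Set (c ⊔ ℓ)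
  FactorsThrough {a} {b} q M = ∃₂ λ (A : Matrix a q) (B : Matrix q b) → M ≋ A · B

  HasRank : ∀ {a b} → ℕ → Matrix a b → Set (c ⊔ ℓ)
  HasRank s M = IdentityMinor s M × FactorsThrough s M

  minor≤factor : ∀ {a b s q} {M : Matrix a b} → IdentityMinor s M → FactorsThrough q M → s ≤ q
  minor≤factor (ρ , σ , M[ρ,σ]≈I) (A , B , M≋AB) =
    identity-factorisation⇒≤ (λ t l → A (ρ t) l) (λ l t' → B l (σ t'))
      (λ t t' → trans (sym (M[ρ,σ]≈I t t')) (M≋AB (ρ t) (σ t')))

  FactorsThrough-equivalent : ∀ {a b q} {M M' : Matrix a b} → Equivalent M M' →
                              FactorsThrough q M → FactorsThrough q M'
  FactorsThrough-equivalent (equivalent P Q _ _ M'≋PMQ) (A , B , M≋AB) = P · A , B · Q , (begin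
    _                ≈⟨ M'≋PMQ ⟩
    P · _ · Q        ≈⟨ ·-congʳ Q (·-congˡ P M≋AB) ⟩
    P · (A · B) · Q  ≈⟨ ·-congʳ Q (·-assoc P A B) ⟨
    P · A · B · Q    ≈⟨ ·-assoc (P · A) B Q ⟩
    P · A · (B · Q)  ∎)
    where open ≋-Reasoning

  HasRank-idBlock : ∀ {a b k} → k ≤ a → k ≤ b → HasRank k (idBlock {a} {b} k)
  HasRank-idBlock {k = k} k≤a k≤b =
    ((λ t → inject≤ t k≤a) , (λ t → inject≤ t k≤b) , idBlock-inject≤ k k≤a k≤b) ,
    (idBlock k , idBlock k , idBlock-factor k)

  rank-unique : ∀ {a b s s'} {M M' : Matrix a b} → Equivalent M M' → HasRank s M → HasRank s' M' → s ≡ s'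
  rank-unique M~M' (minor , factors) (minor' , factors') =
    ℕ.≤-antisym (minor≤factor minor (FactorsThrough-equivalent (Equivalent-sym M~M') factors'))
              (minor≤factor minor' (FactorsThrough-equivalent M~M' factors))

  sameRank⇒Equivalent : ∀ {a b s} {M M' : Matrix a b} → HasRank s M → HasRank s M' → Equivalent M M'
  sameRank⇒Equivalent {M = M} {M'} rank rank' with normalForm M | normalForm M'
  ... | k , k≤a , k≤b , D~M | k' , k'≤a , k'≤b , D'~M'
    with ≡.refl ← rank-unique D~M (HasRank-idBlock k≤a k≤b) rank
    with ≡.refl ← rank-unique D'~M' (HasRank-idBlock k'≤a k'≤b) rank'
    = Equivalent-trans (Equivalent-sym D~M) D'~M'

module IndexArithmetic where

  open import Data.Nat using (_+_; _*_)
  open import Data.Nat.Properties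
  open import Data.Bool.Properties using (∨-identityʳ; ∧-zeroʳ)
  open import Data.List using (List; []; _∷_; _++_; length; map; applyUpTo; upTo; concatMap)
  open import Data.List.Properties using (length-map; length-applyUpTo)
  open ≡ using (refl; sym; trans; cong)

  -- Mat.εW is the permutation matrix of i ↦ shift i, the cycle L ↦ a ↦ a + 1 ↦ … ↦ L.
  module ShiftCycle (a L : ℕ) (a≤L : a ≤ L) where

    shift : ℕ → ℕ
    shift i = if i <ᵇ a then i else (if i <ᵇ L then suc i else a)

    unshift : ℕ → ℕ
    unshift j = if j <ᵇ a then j else (if j ≡ᵇ a then L else ℕ.pred j)

    shift-≤ : ∀ i → i ≤ L → shift i ≤ L
    shift-≤ i i≤L with i <? a
    ... | yes i<a rewrite <ᵇ-true i<a = i≤L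
    ... | no  i≮a rewrite <ᵇ-false (≮⇒≥ i≮a) with i <? L
    ...   | yes i<L rewrite <ᵇ-true i<L = i<L
    ...   | no  i≮L rewrite <ᵇ-false (≮⇒≥ i≮L) = a≤L

    unshift-≤ : ∀ j → j ≤ L → unshift j ≤ L
    unshift-≤ j j≤L with j <? a
    ... | yes j<a rewrite <ᵇ-true j<a = j≤L
    ... | no  j≮a rewrite <ᵇ-false (≮⇒≥ j≮a) with j ℕ.≟ a
    ...   | yes refl rewrite ≡ᵇ-true {a} refl = ≤-refl
    ...   | no  j≢a  rewrite ≡ᵇ-false j≢a = ≤-trans pred[n]≤n j≤L

    unshift-shift : ∀ i → i ≤ L → unshift (shift i) ≡ i
    unshift-shift i i≤L with i <? a
    ... | yes i<a rewrite <ᵇ-true i<a | <ᵇ-true i<a = refl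
    ... | no  i≮a rewrite <ᵇ-false (≮⇒≥ i≮a) with i <? L
    ...   | yes i<L rewrite <ᵇ-true i<L | <ᵇ-false {suc i} {a} (m≤n⇒m≤1+n (≮⇒≥ i≮a))
                          | ≡ᵇ-false {suc i} {a} (λ i+1≡a → i≮a (≤-reflexive i+1≡a)) = refl
    ...   | no  i≮L rewrite <ᵇ-false (≮⇒≥ i≮L) | <ᵇ-false {a} {a} ≤-refl | ≡ᵇ-true {a} refl =
      ≤-antisym (≮⇒≥ i≮L) i≤L

    shift-unshift : ∀ j → j ≤ L → shift (unshift j) ≡ j
    shift-unshift j j≤L with j <? a
    ... | yes j<a rewrite <ᵇ-true j<a | <ᵇ-true j<a = refl
    ... | no  j≮a rewrite <ᵇ-false (≮⇒≥ j≮a) with j ℕ.≟ a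
    ...   | yes refl rewrite ≡ᵇ-true {a} refl | <ᵇ-false {L} {a} a≤L | <ᵇ-false {L} {L} ≤-refl = refl
    ...   | no  j≢a  rewrite ≡ᵇ-false j≢a = shift-pred j j≤L j≮a j≢a
      where
      shift-pred : ∀ j → j ≤ L → ¬ j < a → j ≢ a → shift (ℕ.pred j) ≡ j
      shift-pred zero    _    j≮a j≢a = contradiction (≤-antisym z≤n (≮⇒≥ j≮a)) j≢a
      shift-pred (suc j) j<L j≮a j≢a
        rewrite <ᵇ-false {j} {a} (≤-pred (≤∧≢⇒< (≮⇒≥ j≮a) (j≢a ∘ sym))) | <ᵇ-true {j} {L} j<L =
        refl

    shift-L : shift L ≡ a
    shift-L rewrite <ᵇ-false {L} {a} a≤L | <ᵇ-false {L} {L} ≤-refl = refl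

    shift-condition : ∀ i j → i ≤ L →
      (((i <ᵇ a) ∧ (j ≡ᵇ i)) ∨ (((a ≤ᵇ i) ∧ (i <ᵇ L)) ∧ (j ≡ᵇ suc i)) ∨ ((i ≡ᵇ L) ∧ (j ≡ᵇ a)))
        ≡ (shift i ≡ᵇ j)
    shift-condition i j i≤L with i <? a
    ... | yes i<a rewrite <ᵇ-true i<a | ≤ᵇ-false {a} {i} i<a
                        | ≡ᵇ-false {i} {L} (λ i≡L → <⇒≱ i<a (≤-trans a≤L (≤-reflexive (sym i≡L)))) =
      trans (∨-identityʳ (j ≡ᵇ i)) (≡ᵇ-sym j i)
    ... | no  i≮a rewrite <ᵇ-false (≮⇒≥ i≮a) | ≤ᵇ-true (≮⇒≥ i≮a) with i <? L
    ...   | yes i<L rewrite <ᵇ-true i<L | ≡ᵇ-false {i} {L} (<⇒≢ i<L) =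
      trans (∨-identityʳ (j ≡ᵇ suc i)) (≡ᵇ-sym j (suc i))
    ...   | no  i≮L with refl ← ≤-antisym i≤L (≮⇒≥ i≮L)
                    rewrite <ᵇ-false {i} {i} ≤-refl | ≡ᵇ-true {i} refl = ≡ᵇ-sym j a

  offDiagonal : ℕ → List Bool → ℕ → ℕ → Bool
  offDiagonal a b i j = ((i ≡ᵇ a) ∧ (a <ᵇ j)) ∧ nth b (j ∸ suc a)

  offDiagonal-otherRow : ∀ {a i} b j → i ≢ a → offDiagonal a b i j ≡ false
  offDiagonal-otherRow b j i≢a rewrite ≡ᵇ-false i≢a = refl

  offDiagonal-column : ∀ a b i → offDiagonal a b i a ≡ false
  offDiagonal-column a b i rewrite <ᵇ-false {a} {a} ≤-refl | ∧-zeroʳ (i ≡ᵇ a) = refl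

  offDiagonal-diagonal : ∀ a b i → offDiagonal a b i i ≡ false
  offDiagonal-diagonal a b i with i ℕ.≟ a
  ... | yes refl = offDiagonal-column a b a
  ... | no  i≢a  = offDiagonal-otherRow b i i≢a

  nth-++ˡ : ∀ (xs ys : List Bool) {x} → x < length xs → nth (xs ++ ys) x ≡ nth xs x
  nth-++ˡ (b ∷ xs) ys {zero}  _         = refl
  nth-++ˡ (b ∷ xs) ys {suc x} (s≤s x<l) = nth-++ˡ xs ys x<l

  nth-++ʳ : ∀ (xs ys : List Bool) y → nth (xs ++ ys) (length xs + y) ≡ nth ys y
  nth-++ʳ []       ys y = refl
  nth-++ʳ (b ∷ xs) ys y = nth-++ʳ xs ys y

  nth-eRow : ∀ n i {x} → x < n → nth (eRow n i) x ≡ (suc x ≡ᵇ i)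
  nth-eRow n i = go (λ u → u) n
    where
    go : ∀ (f : ℕ → ℕ) n {x} → x < n →
         nth (map (λ u → suc u ≡ᵇ i) (applyUpTo f n)) x ≡ (suc (f x) ≡ᵇ i)
    go f (suc n) {zero}  _         = refl
    go f (suc n) {suc x} (s≤s x<n) = go (f ∘ suc) n x<n

  length-eRow : ∀ n i → length (eRow n i) ≡ n
  length-eRow n i = trans (length-map (λ u → suc u ≡ᵇ i) (upTo n)) (length-applyUpTo (λ u → u) n)

  module ConcatBlocks (n : ℕ) (F : ℕ → List Bool) (length-F : ∀ t → length (F t) ≡ n) where

    nth-blocks : ∀ r (f : ℕ → ℕ) {t x} → t < r → x < n →
                 nth (concatMap F (applyUpTo f r)) (t * n + x) ≡ nth (F (f t)) x
    nth-blocks (suc r) f {zero}  {x} _         x<n =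
      nth-++ˡ (F (f 0)) _ (≡.subst (x <_) (sym (length-F (f 0))) x<n)
    nth-blocks (suc r) f {suc t} {x} (s≤s t<r) x<n = begin
      nth (F (f 0) ++ rest) (n + t * n + x)
        ≡⟨ cong (nth (F (f 0) ++ rest)) (+-assoc n (t * n) x) ⟩
      nth (F (f 0) ++ rest) (n + (t * n + x))
        ≡⟨ cong (λ k → nth (F (f 0) ++ rest) (k + (t * n + x))) (length-F (f 0)) ⟨
      nth (F (f 0) ++ rest) (length (F (f 0)) + (t * n + x))
        ≡⟨ nth-++ʳ (F (f 0)) rest (t * n + x) ⟩
      nth rest (t * n + x)
        ≡⟨ nth-blocks r (f ∘ suc) t<r x<n ⟩
      nth (F (f (suc t))) x ∎
      where
      open ≡.≡-Reasoning
      rest = concatMap F (applyUpTo (f ∘ suc) r)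

    nth-blocks-true⇒ : ∀ r (f : ℕ → ℕ) u → nth (concatMap F (applyUpTo f r)) u ≡ true →
                       ∃ λ t → ∃ λ x → t < r × x < n × u ≡ t * n + x × nth (F (f t)) x ≡ true
    nth-blocks-true⇒ (suc r) f u nth≡true with u <? n
    ... | yes u<n = 0 , u , s≤s z≤n , u<n , refl ,
      trans (sym (nth-++ˡ (F (f 0)) _ (≡.subst (u <_) (sym (length-F (f 0))) u<n))) nth≡true
    ... | no  u≮n with nth-blocks-true⇒ r (f ∘ suc) (u ∸ n) nth-rest≡true
      where
      u≡ : u ≡ length (F (f 0)) + (u ∸ n)
      u≡ = trans (sym (m+[n∸m]≡n (≮⇒≥ u≮n))) (cong (_+ (u ∸ n)) (sym (length-F (f 0))))
      nth-rest≡true : nth (concatMap F (applyUpTo (f ∘ suc) r)) (u ∸ n) ≡ true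
      nth-rest≡true =
        trans (sym (nth-++ʳ (F (f 0)) _ (u ∸ n))) (trans (cong (nth (F (f 0) ++ _)) (sym u≡)) nth≡true)
    ... | t , x , t<r , x<n , u∸n≡ , nth≡ = suc t , x , s≤s t<r , x<n ,
      trans (sym (m+[n∸m]≡n (≮⇒≥ u≮n))) (trans (cong (n +_) u∸n≡) (sym (+-assoc n (t * n) x))) , nth≡

  -- With m = m' + 1 and n = n' + 1, the last row of ε_r has its ones exactly at the
  -- positions n (s + t) + (n' ∸ t), t ≤ r: the index a for t = 0, and the entries of
  -- b_r = (e_{n-1}, …, e_{n-r}) for t ≥ 1.
  module RowPositions (m' n' r : ℕ) (r≤n' : r ≤ n') (n'≤m' : n' ≤ m') where

    open ConcatBlocks (suc n') (λ t → eRow (suc n') (suc n' ∸ suc t)) (λ t → length-eRow (suc n') (suc n' ∸ suc t))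

    n s a : ℕ
    n = suc n'
    s = m' ∸ r
    a = (suc m' ∸ r) * n ∸ 1

    r≤m' : r ≤ m'
    r≤m' = ≤-trans r≤n' n'≤m'

    a≡ : a ≡ n' + s * n
    a≡ = cong (λ k → k * n ∸ 1) (+-∸-assoc 1 r≤m')

    L : ℕ
    L = n' + m' * n

    a+rn≡L : a + r * n ≡ L
    a+rn≡L = begin
      a + r * n               ≡⟨ cong (_+ r * n) a≡ ⟩
      n' + s * n + r * n      ≡⟨ +-assoc n' (s * n) (r * n) ⟩
      n' + (s * n + r * n)    ≡⟨ cong (n' +_) (*-distribʳ-+ n s r) ⟨
      n' + (s + r) * n        ≡⟨ cong (λ k → n' + k * n) (m∸n+n≡m r≤m') ⟩
      n' + m' * n             ∎
      where open ≡.≡-Reasoning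

    a≤L : a ≤ L
    a≤L = ≤-trans (m≤m+n a (r * n)) (≤-reflexive a+rn≡L)

    position : ℕ → ℕ
    position t = n * (s + t) + (n' ∸ t)

    position-zero : position 0 ≡ a
    position-zero = trans (identity n' s) (sym a≡)
      where
      identity : ∀ n' s → suc n' * (s + 0) + n' ≡ n' + s * suc n'
      identity = solve-∀
        where open import Data.Nat.Tactic.RingSolver using (solve-∀)

    position-suc : ∀ t → position (suc t) ≡ suc a + (t * n + (n' ∸ suc t))
    position-suc t = trans (identity n' s t (n' ∸ suc t)) (cong (λ k → suc k + (t * n + (n' ∸ suc t))) (sym a≡))
      where
      identity : ∀ n' s t x → suc n' * (s + suc t) + x ≡ suc (n' + s * suc n') + (t * suc n' + x)
      identity = solve-∀
        where open import Data.Nat.Tactic.RingSolver using (solve-∀)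

    n∸[1+t]≡ : ∀ {t} → t < r → n ∸ suc t ≡ suc (n' ∸ suc t)
    n∸[1+t]≡ {t} t<r = +-∸-assoc 1 (<-≤-trans t<r r≤n')

    offDiagonal-position : ∀ {t} → t < r → offDiagonal a (bRow n r) a (position (suc t)) ≡ true
    offDiagonal-position {t} t<r
      rewrite position-suc t | ≡ᵇ-true {a} refl | <ᵇ-true (s≤s (m≤m+n a (t * n + (n' ∸ suc t))))
            | m+n∸m≡n (suc a) (t * n + (n' ∸ suc t)) =
      trans (nth-blocks r (λ k → k) t<r (s≤s (m∸n≤m n' (suc t))))
            (trans (nth-eRow n (n ∸ suc t) (s≤s (m∸n≤m n' (suc t)))) (≡ᵇ-true (sym (n∸[1+t]≡ t<r))))

    offDiagonal-true⇒position : ∀ J → offDiagonal a (bRow n r) a J ≡ true →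
                                ∃ λ t → t < r × position (suc t) ≡ J
    offDiagonal-true⇒position J offDiag≡true rewrite ≡ᵇ-true {a} refl
      with a <ᵇ J in a<ᵇJ | nth (bRow n r) (J ∸ suc a) in nth≡true
    ... | true | true with nth-blocks-true⇒ r (λ k → k) (J ∸ suc a) nth≡true
    ... | t , x , t<r , x<n , J∸a≡ , eRow≡true = t , t<r , (begin
      position (suc t)                       ≡⟨ position-suc t ⟩
      suc a + (t * n + (n' ∸ suc t))         ≡⟨ cong (λ k → suc a + (t * n + k)) x≡ ⟨
      suc a + (t * n + x)                    ≡⟨ cong (suc a +_) J∸a≡ ⟨
      suc a + (J ∸ suc a)                    ≡⟨ m+[n∸m]≡n (<ᵇ-true⇒< a<ᵇJ) ⟩
      J                                      ∎)
      where
      open ≡.≡-Reasoning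
      x≡ : x ≡ n' ∸ suc t
      x≡ = suc-injective
        (trans (≡ᵇ-true⇒≡ (trans (sym (nth-eRow n (n ∸ suc t) x<n)) eRow≡true)) (n∸[1+t]≡ t<r))

open IndexArithmetic

module NumberFieldMatrices {c ℓ : Level} (K : NumberField c ℓ) where

  open NumberField K
  open Matrices commRing
  open ≋-Reasoning using (≋-refl; ≋-sym; ≋-trans)
  open import Algebra.Properties.Ring ring using (x+x≈x⇒x≈0)
  module MK = Mat K

  ι-0 : ι ℚ.0ℚ ≈ 0#
  ι-0 = x+x≈x⇒x≈0 (ι ℚ.0ℚ) (sym (ι-+ ℚ.0ℚ ℚ.0ℚ))

  -- x ≈ 0 iff all its coordinates in the ℚ-basis vanish.
  ≈0? : ∀ x → Dec (x ≈ 0#)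
  ≈0? x with spanning x
  ... | q , x≈Σqb with all? (λ i → q i ℚ.≟ ℚ.0ℚ)
  ... | yes q≡0 = yes (trans x≈Σqb (trans (reflexive (sumFin≡sum (λ i → ι (q i) * basis i))) (sum-zero qb≈0)))
    where
    qb≈0 : ∀ i → ι (q i) * basis i ≈ 0#
    qb≈0 i = trans (*-congʳ (trans (reflexive (≡.cong ι (q≡0 i))) ι-0)) (zeroˡ (basis i))
  ... | no  q≢0 = no (λ x≈0 → q≢0 (independent q (trans (sym x≈Σqb) x≈0)))

  isDiscreteField : IsDiscreteField commRing
  isDiscreteField = record { 0≉1 = 0≉1 ; inverse = inverse ; ≈0? = ≈0? }

  open Rank commRing isDiscreteField

  ⊗≋· : ∀ {N} (A B : Matrix N N) → A MK.⊗ B ≋ A · B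
  ⊗≋· A B i j = reflexive (sumFin≡sum (λ l → A i l * B l j))

  IsInvertible⇒Invertible : ∀ {N} {A : Matrix N N} → MK.IsInvertible A → Invertible A
  IsInvertible⇒Invertible {A = A} (B , AB≋I , BA≋I) =
    invertible B (≋-trans (≋-sym (⊗≋· A B)) AB≋I) (≋-trans (≋-sym (⊗≋· B A)) BA≋I)

  Invertible⇒IsInvertible : ∀ {N} {A : Matrix N N} → Invertible A → MK.IsInvertible A
  Invertible⇒IsInvertible {A = A} (invertible B AB≋I BA≋I) =
    B , ≋-trans (⊗≋· A B) AB≋I , ≋-trans (⊗≋· B A) BA≋I

  ⊗⊗≋·· : ∀ {N} (p x t : Matrix N N) → (p MK.⊗ x) MK.⊗ t ≋ p · x · t
  ⊗⊗≋·· p x t = ≋-trans (⊗≋· (p MK.⊗ x) t) (·-congʳ t (⊗≋· p x))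

  module _ {L : ℕ} where

    last : Fin (suc L)
    last = fromℕ L

    toℕ≡L⇒≡last : ∀ {i : Fin (suc L)} → toℕ i ≡ L → i ≡ last
    toℕ≡L⇒≡last i≡L = toℕ-injective (≡.trans i≡L (≡.sym (toℕ-fromℕ L)))

    toℕ<L⇒≢last : ∀ {j : Fin (suc L)} → toℕ j < L → j ≢ last
    toℕ<L⇒≢last j<L j≡last = ℕ.<-irrefl (≡.trans (≡.cong toℕ j≡last) (toℕ-fromℕ L)) j<L

    ≢last⇒toℕ<L : ∀ {j : Fin (suc L)} → j ≢ last → toℕ j < L
    ≢last⇒toℕ<L {j} j≢last = ℕ.≤∧≢⇒< (toℕ≤pred[n] j) (j≢last ∘ toℕ≡L⇒≡last)

    lastRow-· : ∀ {b} (p : Matrix (suc L) (suc L)) → (∀ i j → toℕ i ≡ L → toℕ j < L → p i j ≈ 0#) →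
                (X : Matrix (suc L) b) → ∀ j → (p · X) last j ≈ p last last * X last j
    lastRow-· p p-lastRow X j = sum-supported last (λ l l≢last →
      trans (*-congʳ {x = X l j} (p-lastRow last l (toℕ-fromℕ L) (≢last⇒toℕ<L l≢last))) (zeroˡ _))

    sameLastRow⇒parabolic : (x t y : Matrix (suc L) (suc L)) → Invertible x → Invertible t → Invertible y →
      (∀ j → y last j ≈ (x · t) last j) → ∃ λ p → MK.InP p × y ≋ p · x · t
    sameLastRow⇒parabolic x t y x-inv t-inv y-inv lastRows≈ =
      y · Z , (Invertible⇒IsInvertible {A = y · Z} p-inv , p-lastRow) , ≋-sym y≈pxt
      where
      Z : Matrix (suc L) (suc L)
      Z = Invertible.inverse (Invertible-· x-inv t-inv)
      xtZ≋I : x · t · Z ≋ I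
      xtZ≋I = Invertible.inverseʳ (Invertible-· x-inv t-inv)
      Zxt≋I : Z · (x · t) ≋ I
      Zxt≋I = Invertible.inverseˡ (Invertible-· x-inv t-inv)
      p-inv : Invertible (y · Z)
      p-inv = Invertible-· y-inv (Invertible-inverse (Invertible-· x-inv t-inv))
      p-lastRow : ∀ i j → toℕ i ≡ L → toℕ j < L → (y · Z) i j ≈ 0#
      p-lastRow i j i≡L j<L with ≡.refl ← toℕ≡L⇒≡last i≡L =
        trans (sum-cong-≋ (λ l → *-congʳ {x = Z l j} (lastRows≈ l)))
              (trans (xtZ≋I last j) (δ-≢ (toℕ<L⇒≢last j<L ∘ ≡.sym)))
      y≈pxt : y · Z · x · t ≋ y
      y≈pxt = begin
        y · Z · x · t       ≈⟨ ·-assoc (y · Z) x t ⟩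
        y · Z · (x · t)     ≈⟨ ·-assoc y Z (x · t) ⟩
        y · (Z · (x · t))   ≈⟨ ·-congˡ y Zxt≋I ⟩
        y · I               ≈⟨ ·-identityʳ y ⟩
        y                   ∎
        where open ≋-Reasoning

    parabolic-corner-invertible : ∀ {p} → MK.InP p → ∃ λ e → p last last * e ≈ 1#
    parabolic-corner-invertible {p} (p-inv , p-lastRow) with IsInvertible⇒Invertible {A = p} p-inv
    ... | invertible p' pp'≋I _ =
      p' last last , trans (sym (lastRow-· p p-lastRow p' last)) (trans (pp'≋I last last) (δ-refl last))

  module _ {m' n' : ℕ} where

    private
      m n : ℕ
      m = suc m'
      n = suc n'

    lastRow : Matrix (m ℕ.* n) (m ℕ.* n) → Matrix m n
    lastRow x = reshape (x last)

    equivalentLastRows⇒sameDoubleCoset : ∀ {x y} → Invertible x → Invertible y →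
      Equivalent (lastRow x) (lastRow y) → MK.SameDoubleCoset m n x y
    equivalentLastRows⇒sameDoubleCoset {x} {y} x-inv y-inv (equivalent P Q P-inv Q-inv Y≋PXQ) =
      let (p , p∈P , y≋pxt) = sameLastRow⇒parabolic x t y x-inv t-inv y-inv lastRows≈ in
      p , t , p∈P ,
      (P ᵀ , Q , Invertible⇒IsInvertible (Invertible-ᵀ P-inv) , Invertible⇒IsInvertible Q-inv , ≋-refl) ,
      ≋-trans y≋pxt (≋-sym (⊗⊗≋·· p x t))
      where
      t : Matrix (m ℕ.* n) (m ℕ.* n)
      t = kron (P ᵀ) Q
      t-inv : Invertible t
      t-inv = Invertible-kron (Invertible-ᵀ P-inv) Q-inv
      lastRows≈ : ∀ J → y last J ≈ (x · t) last J
      lastRows≈ = ≈-combine {m} {n} (λ i j → trans (Y≋PXQ i j) (sym (reshape-·kron (x last) (P ᵀ) Q i j)))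

    sameDoubleCoset⇒equivalentLastRows : ∀ {x y} → MK.SameDoubleCoset m n x y → Equivalent (lastRow x) (lastRow y)
    sameDoubleCoset⇒equivalentLastRows {x} {y} (p , t , p∈P , (h , g , h-inv , g-inv , t≋hg) , y≋pxt) =
      equivalent (d ◃ h ᵀ) g
        (Invertible-◃ (proj₂ (parabolic-corner-invertible p∈P)) (Invertible-ᵀ (IsInvertible⇒Invertible h-inv)))
        (IsInvertible⇒Invertible g-inv) Y≋dhᵀXg
      where
      d : Carrier
      d = p last last
      Y≋dhᵀXg : lastRow y ≋ (d ◃ h ᵀ) · lastRow x · g
      Y≋dhᵀXg i j = begin
        y last (combine i j)                      ≈⟨ y≋pxt last (combine i j) ⟩
        ((p MK.⊗ x) MK.⊗ t) last (combine i j)    ≈⟨ ⊗⊗≋·· p x t last (combine i j) ⟩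
        (p · x · t) last (combine i j)            ≈⟨ ·-assoc p x t last (combine i j) ⟩
        (p · (x · t)) last (combine i j)          ≈⟨ lastRow-· p (proj₂ p∈P) (x · t) (combine i j) ⟩
        d * (x · t) last (combine i j)            ≈⟨ *-congˡ (·-congˡ x t≋hg last (combine i j)) ⟩
        d * (x · kron h g) last (combine i j)     ≈⟨ *-congˡ (reshape-·kron (x last) h g i j) ⟩
        d * (h ᵀ · lastRow x · g) i j             ≈⟨ ◃-· d (h ᵀ · lastRow x) g i j ⟨
        (d ◃ (h ᵀ · lastRow x) · g) i j           ≈⟨ ·-congʳ g (◃-· d (h ᵀ) (lastRow x)) i j ⟨
        (d ◃ h ᵀ · lastRow x · g) i j             ∎
        where open ≈-Reasoning

module Representatives {c ℓ : Level} (K : NumberField c ℓ) {m' n' : ℕ} (n'≤m' : n' ≤ m')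
                       {r : ℕ} (r≤n' : r ≤ n') where

  open NumberField K
  open Matrices commRing
  open ≋-Reasoning using (≋-refl; ≋-sym; ≋-trans)
  open NumberFieldMatrices K
  open Rank commRing isDiscreteField
  open RowPositions m' n' r r≤n' n'≤m'
  open ShiftCycle a L a≤L

  m : ℕ
  m = suc m'

  shiftFin unshiftFin : Fin (m ℕ.* n) → Fin (m ℕ.* n)
  shiftFin   i = fromℕ< (s≤s (shift-≤ (toℕ i) (toℕ≤pred[n] i)))
  unshiftFin j = fromℕ< (s≤s (unshift-≤ (toℕ j) (toℕ≤pred[n] j)))

  toℕ-shiftFin : ∀ i → toℕ (shiftFin i) ≡ shift (toℕ i)
  toℕ-shiftFin i = toℕ-fromℕ< _

  toℕ-unshiftFin : ∀ j → toℕ (unshiftFin j) ≡ unshift (toℕ j)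
  toℕ-unshiftFin j = toℕ-fromℕ< _

  shiftPermutation : Permutation′ (m ℕ.* n)
  shiftPermutation = permutation shiftFin unshiftFin
    (λ j → toℕ-injective (≡.trans (toℕ-shiftFin (unshiftFin j))
             (≡.trans (≡.cong shift (toℕ-unshiftFin j)) (shift-unshift (toℕ j) (toℕ≤pred[n] j)))))
    (λ i → toℕ-injective (≡.trans (toℕ-unshiftFin (shiftFin i))
             (≡.trans (≡.cong unshift (toℕ-shiftFin i)) (unshift-shift (toℕ i) (toℕ≤pred[n] i)))))

  εW≋permutation : Mat.εW K m n r ≋ permutationMatrix shiftPermutation
  εW≋permutation i j = reflexive (≡.cong (Mat.fromBool K) (≡.trans (≡.cong condition a+rn≡L)
    (≡.trans (shift-condition (toℕ i) (toℕ j) (toℕ≤pred[n] i)) (≡.cong (_≡ᵇ toℕ j) (≡.sym (toℕ-shiftFin i))))))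
    where
    condition : ℕ → Bool
    condition U = ((toℕ i <ᵇ a) ∧ (toℕ j ≡ᵇ toℕ i))
                ∨ (((a ≤ᵇ toℕ i) ∧ (toℕ i <ᵇ U)) ∧ (toℕ j ≡ᵇ suc (toℕ i)))
                ∨ ((toℕ i ≡ᵇ L) ∧ (toℕ j ≡ᵇ a))

  -- Mat.εU = I + E, where E lives in row a strictly right of the diagonal, so E² = 0.
  E : Matrix (m ℕ.* n) (m ℕ.* n)
  E i j = Mat.fromBool K (offDiagonal a (bRow n r) (toℕ i) (toℕ j))

  εU≋I+E : Mat.εU K m n r ≋ I+ E
  εU≋I+E i j with toℕ i ≡ᵇ toℕ j in i≡ᵇj
  ... | true  rewrite ≡ᵇ-true⇒≡ {toℕ i} i≡ᵇj | offDiagonal-diagonal a (bRow n r) (toℕ j) =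
    sym (+-identityʳ 1#)
  ... | false = sym (+-identityˡ _)

  E·E≋0 : E · E ≋ λ _ _ → 0#
  E·E≋0 i j = sum-zero EilElj≈0
    where
    EilElj≈0 : ∀ l → E i l * E l j ≈ 0#
    EilElj≈0 l with toℕ l ℕ.≟ a
    ... | yes l≡a rewrite l≡a | offDiagonal-column a (bRow n r) (toℕ i) = zeroˡ _
    ... | no  l≢a rewrite offDiagonal-otherRow (bRow n r) (toℕ j) l≢a = zeroʳ _

  ε≋εW·εU : Mat.ε K m n r ≋ Mat.εW K m n r · Mat.εU K m n r
  ε≋εW·εU = ⊗≋· (Mat.εW K m n r) (Mat.εU K m n r)

  Invertible-ε : Invertible (Mat.ε K m n r)
  Invertible-ε = Invertible-cong (≋-sym ε≋εW·εU)
    (Invertible-· (Invertible-cong (≋-sym εW≋permutation) (Invertible-permutationMatrix shiftPermutation))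
                  (Invertible-cong (≋-sym εU≋I+E) (Invertible-I+nilpotent E·E≋0)))

  s+t<m : ∀ (t : Fin (suc r)) → s ℕ.+ toℕ t < m
  s+t<m t = s≤s (ℕ.≤-trans (ℕ.+-monoʳ-≤ s (toℕ≤pred[n] t)) (ℕ.≤-reflexive (ℕ.m∸n+n≡m r≤m')))

  n'∸t<n : ∀ (t : Fin (suc r)) → n' ∸ toℕ t < n
  n'∸t<n t = s≤s (ℕ.m∸n≤m n' (toℕ t))

  ρ : Fin (suc r) → Fin m
  ρ t = fromℕ< (s+t<m t)

  σ : Fin (suc r) → Fin n
  σ t = fromℕ< (n'∸t<n t)

  ρ-injective : ∀ {t t'} → ρ t ≡ ρ t' → t ≡ t'
  ρ-injective {t} {t'} =
    toℕ-injective ∘ ℕ.+-cancelˡ-≡ s (toℕ t) (toℕ t') ∘ Fin.fromℕ<-injective _ _ (s+t<m t) (s+t<m t')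

  σ-injective : ∀ {t t'} → σ t ≡ σ t' → t ≡ t'
  σ-injective {t} {t'} =
    toℕ-injective ∘ ℕ.∸-cancelˡ-≡ (t≤n' t) (t≤n' t') ∘ Fin.fromℕ<-injective _ _ (n'∸t<n t) (n'∸t<n t')
    where
    t≤n' : ∀ t → toℕ t ≤ n'
    t≤n' t = ℕ.≤-trans (toℕ≤pred[n] t) r≤n'

  positionFin : Fin (suc r) → Fin (m ℕ.* n)
  positionFin t = combine (ρ t) (σ t)

  toℕ-positionFin : ∀ t → toℕ (positionFin t) ≡ position (toℕ t)
  toℕ-positionFin t = ≡.trans (toℕ-combine (ρ t) (σ t))
    (≡.cong₂ (λ i j → n ℕ.* i ℕ.+ j) (toℕ-fromℕ< (s+t<m t)) (toℕ-fromℕ< (n'∸t<n t)))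

  positionFin-injective : ∀ {t t'} → positionFin t ≡ positionFin t' → t ≡ t'
  positionFin-injective {t} {t'} = ρ-injective ∘ combine-injectiveˡ (ρ t) (σ t) (ρ t') (σ t')

  aFin : Fin (m ℕ.* n)
  aFin = shiftFin last

  toℕ-aFin : toℕ aFin ≡ a
  toℕ-aFin = ≡.trans (toℕ-shiftFin last) (≡.trans (≡.cong shift (toℕ-fromℕ L)) shift-L)

  lastRow-ε : ∀ J → Mat.ε K m n r last J ≈ Mat.εU K m n r aFin J
  lastRow-ε J = begin
    Mat.ε K m n r last J
      ≈⟨ ε≋εW·εU last J ⟩
    sum (λ l → Mat.εW K m n r last l * εU l J)
      ≈⟨ sum-cong-≋ (λ l → *-congʳ {x = εU l J} (εW≋permutation last l)) ⟩
    sum (λ l → δ aFin l * εU l J)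
      ≈⟨ sum-δˡ aFin (λ l → εU l J) ⟩
    εU aFin J ∎
    where
    open ≈-Reasoning
    εU : Matrix (m ℕ.* n) (m ℕ.* n)
    εU = Mat.εU K m n r

  εU-aFin≈ : ∀ J → Mat.εU K m n r aFin J ≈ sum (λ t → δ (positionFin t) J)
  εU-aFin≈ J rewrite toℕ-aFin with a ℕ.≟ toℕ J
  ... | yes a≡J rewrite ≡ᵇ-true a≡J =
    sym (sum-δ-hit positionFin positionFin-injective {Fin.zero}
      (toℕ-injective (≡.trans (toℕ-positionFin Fin.zero) (≡.trans position-zero a≡J))))
  ... | no  a≢J rewrite ≡ᵇ-false a≢J with offDiagonal a (bRow n r) a (toℕ J) in offDiagonal≡
  ...   | true with offDiagonal-true⇒position (toℕ J) offDiagonal≡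
  ...     | t , t<r , position≡J =
    sym (sum-δ-hit positionFin positionFin-injective {Fin.suc (fromℕ< t<r)}
      (toℕ-injective (≡.trans (toℕ-positionFin (Fin.suc (fromℕ< t<r)))
                              (≡.trans (≡.cong (position ∘ suc) (toℕ-fromℕ< t<r)) position≡J))))
  εU-aFin≈ J | no a≢J | false = sym (sum-δ-miss positionFin miss)
    where
    toℕ-J : ∀ {t} → positionFin t ≡ J → position (toℕ t) ≡ toℕ J
    toℕ-J {t} p≡J = ≡.trans (≡.sym (toℕ-positionFin t)) (≡.cong toℕ p≡J)
    miss : ∀ t → positionFin t ≢ J
    miss Fin.zero    p≡J = a≢J (≡.trans (≡.sym position-zero) (toℕ-J p≡J))
    miss (Fin.suc t) p≡J = contradiction (≡.trans (≡.sym (offDiagonal-position (toℕ<n t)))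
      (≡.trans (≡.cong (offDiagonal a (bRow n r) a) (toℕ-J p≡J)) offDiagonal≡)) λ ()

  lastRow-ε≋ : lastRow (Mat.ε K m n r) ≋ (λ i t → δ (ρ t) i) · (λ t j → δ (σ t) j)
  lastRow-ε≋ i j = trans (lastRow-ε (combine i j))
    (trans (εU-aFin≈ (combine i j)) (sum-cong-≋ (λ t → δ-combine (ρ t) i (σ t) j)))

  HasRank-lastRow-ε : HasRank (suc r) (lastRow (Mat.ε K m n r))
  HasRank-lastRow-ε = (ρ , σ , minor) , ((λ i t → δ (ρ t) i) , (λ t j → δ (σ t) j) , lastRow-ε≋)
    where
    minor : ∀ t t' → lastRow (Mat.ε K m n r) (ρ t) (σ t') ≈ δ t t'
    minor t t' = begin
      lastRow (Mat.ε K m n r) (ρ t) (σ t')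
        ≈⟨ lastRow-ε≋ (ρ t) (σ t') ⟩
      sum (λ u → δ (ρ u) (ρ t) * δ (σ u) (σ t'))
        ≈⟨ sum-cong-≋ (λ u → *-congʳ {x = δ (σ u) (σ t')} (δ-injective ρ ρ-injective u t)) ⟩
      sum (λ u → δ u t * δ (σ u) (σ t'))
        ≈⟨ sum-cong-≋ (λ u → *-comm (δ u t) (δ (σ u) (σ t'))) ⟩
      sum (λ u → δ (σ u) (σ t') * δ u t)
        ≈⟨ sum-δʳ t (λ u → δ (σ u) (σ t')) ⟩
      δ (σ t) (σ t')
        ≈⟨ δ-injective σ σ-injective t t' ⟩
      δ t t' ∎
      where open ≈-Reasoning

-- Imported this late because the modules above open rings, whose _*_ would clash.
open import Data.Nat using (_*_)

module _ {c ℓ} (K : NumberField c ℓ) {m' n' : ℕ} (n'≤m' : n' ≤ m') where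

  open Matrices (NumberField.commRing K)
  open NumberFieldMatrices K
  open Rank (NumberField.commRing K) isDiscreteField

  private
    m n : ℕ
    m = suc m'
    n = suc n'
    module ε-at (r : Fin n) = Representatives K n'≤m' (toℕ≤pred[n] r)

  ε-invertible : ∀ (r : Fin n) → Mat.IsInvertible K (Mat.ε K m n (toℕ r))
  ε-invertible r = Invertible⇒IsInvertible (ε-at.Invertible-ε r)

  ε-exhaustive : ∀ (g : Mat.Matrix K (m * n)) → Mat.IsInvertible K g →
                 ∃ λ (r : Fin n) → Mat.SameDoubleCoset K m n (Mat.ε K m n (toℕ r)) g
  ε-exhaustive g g-inv = fromNormalForm (normalForm (lastRow g))
    where
    g-invertible : Invertible g
    g-invertible = IsInvertible⇒Invertible g-inv
    fromNormalForm : (∃ λ k → k ≤ m × k ≤ n × Equivalent (idBlock k) (lastRow g)) →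
                     ∃ λ (r : Fin n) → Mat.SameDoubleCoset K m n (Mat.ε K m n (toℕ r)) g
    fromNormalForm (zero , _ , _ , 0~G) =
      contradiction (Invertible.inverseʳ g-invertible)
        (zeroRow⇒¬rightInverse {A = g} {B = Invertible.inverse g-invertible} {i = last}
          (≈-combine {m} {n} {u = g last} {v = λ _ → NumberField.0# K} (Equivalent-idBlock-zero 0~G)))
    fromNormalForm (suc k , k<m , k<n , D~G) =
      fromℕ< k<n , equivalentLastRows⇒sameDoubleCoset (ε-at.Invertible-ε (fromℕ< k<n)) g-invertible
        (Equivalent-trans (sameRank⇒Equivalent (ε-at.HasRank-lastRow-ε (fromℕ< k<n)) D-rank) D~G)
      where
      D-rank : HasRank (suc (toℕ (fromℕ< k<n))) (idBlock (suc k))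
      D-rank rewrite toℕ-fromℕ< k<n = HasRank-idBlock k<m k<n

  ε-distinct : ∀ (r s : Fin n) →
               Mat.SameDoubleCoset K m n (Mat.ε K m n (toℕ r)) (Mat.ε K m n (toℕ s)) → r ≡ s
  ε-distinct r s εr~εs = toℕ-injective (ℕ.suc-injective (rank-unique
    (sameDoubleCoset⇒equivalentLastRows {x = Mat.ε K m n (toℕ r)} {y = Mat.ε K m n (toℕ s)} εr~εs)
    (ε-at.HasRank-lastRow-ε r) (ε-at.HasRank-lastRow-ε s)))

theorem2p1 : ∀ {c ℓ} (K : NumberField c ℓ) (m n : ℕ) → 1 ≤ n → n ≤ m →
    (∀ (r : Fin n) → Mat.IsInvertible K (Mat.ε K m n (toℕ r)))
    × (∀ (g : Mat.Matrix K (m * n)) → Mat.IsInvertible K g →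
        ∃ λ (r : Fin n) → Mat.SameDoubleCoset K m n (Mat.ε K m n (toℕ r)) g)
    × (∀ (r s : Fin n) →
        Mat.SameDoubleCoset K m n (Mat.ε K m n (toℕ r)) (Mat.ε K m n (toℕ s)) → r ≡ s)
theorem2p1 K (suc m') (suc n') (s≤s z≤n) (s≤s n'≤m') =
  ε-invertible K n'≤m' , ε-exhaustive K n'≤m' , ε-distinct K n'≤m'
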